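{- Let $n$, $k$ and $l$ be integers with $1\leq k<l\leq n-1$ and $k+l\leq n$, and let $G(n,k,l)$ be the set-inclusion graph. Then $$\mathrm{Aut}(G(n,k,l))\cong \begin{cases} S_n& \text{if } k+l<n,\\ S_n\times \mathbb{Z}_2 & \text{if } k+l=n, \end{cases} $$ where $S_n$ is the symmetric group on $[n]$ and $\mathbb{Z}_2$ is the cyclic group of order $2$.
   Context: For integers $1\leq k<l\leq n-1$, the set-inclusion graph $G(n,k,l)$ is the simple graph whose vertex set consists of all $k$-subsets and all $l$-subsets of $[n]=\{1,\dots,n\}$, two distinct vertices being adjacent iff one of them is contained in the other. $\mathrm{Aut}(G)$ denotes the group of all permutations of the vertex set preserving adjacency. -}

module Defs where

open import Level using (0ℓ)
open import Data.Nat using (ℕ)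
open import Data.Bool using (Bool; true; false; _xor_)
open import Data.Fin.Subset using (Subset; _⊆_; ∣_∣)
open import Data.Product using (Σ; _×_; _,_; proj₁)
open import Data.Sum using (_⊎_)
open import Relation.Nullary using (¬_)
open import Relation.Binary.PropositionalEquality using (_≡_; refl; trans; cong; sym; subst₂)
open import Function using (_∘_; _⇔_)
import Function
open import Algebra.Bundles.Raw using (RawGroup)
open import Algebra.Morphism.Structures using (module GroupMorphisms)
import Algebra.Construct.DirectProduct as DP
open import Data.Fin.Permutation as P using (Permutation′; _⟨$⟩ʳ_; _∘ₚ_)

Vertex : ℕ → ℕ → ℕ → Set
Vertex n k l = Σ (Subset n) (λ s → (∣ s ∣ ≡ k) ⊎ (∣ s ∣ ≡ l))

Adj : ∀ {n k l} → Vertex n k l → Vertex n k l → Set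
Adj u v = ¬ (proj₁ u ≡ proj₁ v) × ((proj₁ u ⊆ proj₁ v) ⊎ (proj₁ v ⊆ proj₁ u))

record Aut (n k l : ℕ) : Set where
  field
    to       : Vertex n k l → Vertex n k l
    from     : Vertex n k l → Vertex n k l
    to-from  : ∀ v → to (from v) ≡ v
    from-to  : ∀ v → from (to v) ≡ v
    adj      : ∀ u v → Adj u v ⇔ Adj (to u) (to v)

open Aut

AutGroup : ℕ → ℕ → ℕ → RawGroup 0ℓ 0ℓ
AutGroup n k l = record
  { Carrier = Aut n k l
  ; _≈_ = λ f g → ∀ v → to f v ≡ to g v
  ; _∙_ = λ f g → record
      { to = to f ∘ to g
      ; from = from g ∘ from f
      ; to-from = λ v → trans (cong (to f) (to-from g (from f v))) (to-from f v)
      ; from-to = λ v → trans (cong (from g) (from-to f (to g v))) (from-to g v)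
      ; adj = λ u v → Function.mk⇔
          (λ a → Function.Equivalence.to (adj f (to g u) (to g v))
                   (Function.Equivalence.to (adj g u v) a))
          (λ a → Function.Equivalence.from (adj g u v)
                   (Function.Equivalence.from (adj f (to g u) (to g v)) a))
      }
  ; ε = record
      { to = λ v → v ; from = λ v → v
      ; to-from = λ v → refl ; from-to = λ v → refl
      ; adj = λ u v → Function.mk⇔ (λ a → a) (λ a → a) }
  ; _⁻¹ = inv
  }
  where
  inv : Aut n k l → Aut n k l
  inv f = record
      { to = from f ; from = to f
      ; to-from = from-to f ; from-to = to-from f
      ; adj = λ u v → Function.mk⇔
          (λ a → Function.Equivalence.from (adj f (from f u) (from f v))
                   (subst₂ Adj (sym (to-from f u)) (sym (to-from f v)) a))
          (λ a → subst₂ Adj (to-from f u) (to-from f v)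
                   (Function.Equivalence.to (adj f (from f u) (from f v)) a))
      }

Sym : ℕ → RawGroup 0ℓ 0ℓ
Sym n = record
  { Carrier = Permutation′ n
  ; _≈_ = P._≈_
  ; _∙_ = _∘ₚ_
  ; ε = P.id
  ; _⁻¹ = P.flip
  }

Z₂ : RawGroup 0ℓ 0ℓ
Z₂ = record
  { Carrier = Bool
  ; _≈_ = _≡_
  ; _∙_ = _xor_
  ; ε = false
  ; _⁻¹ = λ b → b
  }

Sym×Z₂ : ℕ → RawGroup 0ℓ 0ℓ
Sym×Z₂ n = DP.rawGroup (Sym n) Z₂

_≅_ : RawGroup 0ℓ 0ℓ → RawGroup 0ℓ 0ℓ → Set
G ≅ H = Σ (RawGroup.Carrier G → RawGroup.Carrier H)
          (GroupMorphisms.IsGroupIsomorphism G H)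

-- An automorphism of G(n,k,l) either preserves or swaps the two sides, as the graph is
-- connected and bipartite. Complementing the images in the swapping case, it becomes an
-- inclusion-preserving bijection from the layers (k, l) of the Boolean lattice on [n] to
-- layers (j′, m′), with j′ = n − l if it swaps. Johnson adjacency of j-sets (differing in one
-- element) is expressible through inclusions into m-sets, so such a bijection preserves it;
-- as distinct covers of a (j−1)-set meet exactly in it, the bijection descends to the layers
-- (j−1, j). Descending to singletons shows j = j′ and that the bijection is induced by a
-- permutation of [n]. Hence swapping forces k + l = n, and every automorphism is
-- S ↦ π⁻¹(S), possibly followed by complementation.

module Submission where

open import Defs
open import Level using (0ℓ)
open import Data.Nat using (ℕ; zero; suc; _+_; _∸_; _≤_; _<_; z≤n; s≤s)
open import Data.Nat.Properties
open import Data.Bool using (Bool; true; false; not; _xor_; if_then_else_)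
import Data.Bool as Bool
open import Data.Bool.Properties using (not-involutive; xor-same; xor-identityʳ; ¬-not)
open import Data.Fin using (Fin; zero; suc)
import Data.Fin.Properties as Fin
open import Data.Fin.Subset
open import Data.Fin.Subset.Properties
open import Data.Vec using ([]; _∷_; here; there; lookup; tabulate)
import Data.Vec.Properties as Vec
open import Data.Product using (Σ; ∃; _×_; _,_; proj₁; proj₂)
open import Data.Sum using (_⊎_; inj₁; inj₂; [_,_])
open import Data.Empty using () renaming (⊥-elim to absurd)
open import Relation.Nullary using (¬_; Dec; yes; no)
open import Relation.Binary.PropositionalEquality hiding ([_])
open import Data.Fin.Permutation as P using (Permutation′; _⟨$⟩ʳ_; _⟨$⟩ˡ_; _∘ₚ_)
open import Algebra.Properties.CommutativeMonoid.Sum +-0-commutativeMonoid using (sum; sum-permute; sum-cong-≗)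
open import Function using (_∘′_)
open import Function.Bundles using (Equivalence; mk⇔)
open import Relation.Binary.Structures using (IsEquivalence)
open import Relation.Binary.Bundles using (Setoid)
import Relation.Binary.Reasoning.Setoid as ≈-Reasoning
open import Algebra.Bundles.Raw using (RawGroup)
open import Algebra.Definitions using (Congruent₁; Congruent₂)
open import Algebra.Morphism.Structures using (module GroupMorphisms)

private variable
  n : ℕ
  x y : Fin n
  p q : Subset n

-- Counting and choosing subsets

AtMostOne : Subset n → Set
AtMostOne p = ∀ {x y} → x ∈ p → y ∈ p → x ≡ y

x∈p─q⁻ : ∀ (p q : Subset n) → x ∈ p ─ q → x ∈ p × x ∉ q
x∈p─q⁻ {x = zero}  (s ∷ p) (false ∷ q) here = here , λ ()
x∈p─q⁻ {x = suc x} (s ∷ p) (t ∷ q) (there x∈p─q) =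
  let x∈p , x∉q = x∈p─q⁻ p q x∈p─q in there x∈p , λ { (there x∈q) → x∉q x∈q }

∁-involutive : (p : Subset n) → ∁ (∁ p) ≡ p
∁-involutive p = trans (sym (Vec.map-∘ not not p)) (trans (Vec.map-cong not-involutive p) (Vec.map-id p))

∣p∣≡∣p∩q∣+∣p─q∣ : (p q : Subset n) → ∣ p ∣ ≡ ∣ p ∩ q ∣ + ∣ p ─ q ∣
∣p∣≡∣p∩q∣+∣p─q∣ []          []          = refl
∣p∣≡∣p∩q∣+∣p─q∣ (true ∷ p)  (true ∷ q)  = cong suc (∣p∣≡∣p∩q∣+∣p─q∣ p q)
∣p∣≡∣p∩q∣+∣p─q∣ (true ∷ p)  (false ∷ q) = trans (cong suc (∣p∣≡∣p∩q∣+∣p─q∣ p q)) (sym (+-suc _ _))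
∣p∣≡∣p∩q∣+∣p─q∣ (false ∷ p) (true ∷ q)  = ∣p∣≡∣p∩q∣+∣p─q∣ p q
∣p∣≡∣p∩q∣+∣p─q∣ (false ∷ p) (false ∷ q) = ∣p∣≡∣p∩q∣+∣p─q∣ p q

∣p∪q∣≡∣p∣+∣q─p∣ : (p q : Subset n) → ∣ p ∪ q ∣ ≡ ∣ p ∣ + ∣ q ─ p ∣
∣p∪q∣≡∣p∣+∣q─p∣ []          []          = refl
∣p∪q∣≡∣p∣+∣q─p∣ (true ∷ p)  (_ ∷ q)     = cong suc (∣p∪q∣≡∣p∣+∣q─p∣ p q)
∣p∪q∣≡∣p∣+∣q─p∣ (false ∷ p) (true ∷ q)  = trans (cong suc (∣p∪q∣≡∣p∣+∣q─p∣ p q)) (sym (+-suc _ _))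
∣p∪q∣≡∣p∣+∣q─p∣ (false ∷ p) (false ∷ q) = ∣p∪q∣≡∣p∣+∣q─p∣ p q

x∈p⇒0<∣p∣ : x ∈ p → 0 < ∣ p ∣
x∈p⇒0<∣p∣ {x = x} {p} x∈p = ≤-trans (≤-reflexive (sym (∣⁅x⁆∣≡1 x)))
  (p⊆q⇒∣p∣≤∣q∣ (λ y∈⁅x⁆ → subst (_∈ p) (sym (x∈⁅y⁆⇒x≡y x y∈⁅x⁆)) x∈p))

0<∣p∣⇒Nonempty : (p : Subset n) → 0 < ∣ p ∣ → Nonempty p
0<∣p∣⇒Nonempty (true ∷ p)  _     = zero , here
0<∣p∣⇒Nonempty (false ∷ p) 0<∣p∣ = let x , x∈p = 0<∣p∣⇒Nonempty p 0<∣p∣ in suc x , there x∈p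

⊆⊎∃∈─ : (p q : Subset n) → p ⊆ q ⊎ ∃ λ x → x ∈ p × x ∉ q
⊆⊎∃∈─ p q with nonempty? (p ─ q)
... | yes (x , x∈p─q) = inj₂ (x , x∈p─q⁻ p q x∈p─q)
... | no p─q-empty = inj₁ p⊆q
  where
  p⊆q : p ⊆ q
  p⊆q {x} x∈p with x ∈? q
  ... | yes x∈q = x∈q
  ... | no x∉q = absurd (p─q-empty (x , x∈p∧x∉q⇒x∈p─q x∈p x∉q))

p⊆q∧∣q∣≤∣p∣⇒p≡q : p ⊆ q → ∣ q ∣ ≤ ∣ p ∣ → p ≡ q
p⊆q∧∣q∣≤∣p∣⇒p≡q {p = p} {q} p⊆q ∣q∣≤∣p∣ with ⊆⊎∃∈─ q p
... | inj₁ q⊆p = ⊆-antisym p⊆q q⊆p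
... | inj₂ (x , x∈q , x∉p) = absurd (<⇒≱ (p⊂q⇒∣p∣<∣q∣ (p⊆q , x , x∈q , x∉p)) ∣q∣≤∣p∣)

∣p∣≤∣q∣⇒∃∈q─p : ∣ p ∣ ≤ ∣ q ∣ → p ≢ q → ∃ λ x → x ∈ q × x ∉ p
∣p∣≤∣q∣⇒∃∈q─p {p = p} {q} ∣p∣≤∣q∣ p≢q with ⊆⊎∃∈─ q p
... | inj₁ q⊆p = absurd (p≢q (sym (p⊆q∧∣q∣≤∣p∣⇒p≡q q⊆p ∣p∣≤∣q∣)))
... | inj₂ w = w

AtMostOne⇒≡⁅x⁆ : AtMostOne p → x ∈ p → p ≡ ⁅ x ⁆
AtMostOne⇒≡⁅x⁆ {p = p} {x} p≤1 x∈p = ⊆-antisym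
  (λ y∈p → subst (_∈ ⁅ x ⁆) (p≤1 x∈p y∈p) (x∈⁅x⁆ x))
  (λ {y} y∈⁅x⁆ → subst (_∈ p) (sym (x∈⁅y⁆⇒x≡y x y∈⁅x⁆)) x∈p)

AtMostOne⇒∣p∣≡1 : AtMostOne p → x ∈ p → ∣ p ∣ ≡ 1
AtMostOne⇒∣p∣≡1 {x = x} p≤1 x∈p = trans (cong ∣_∣ (AtMostOne⇒≡⁅x⁆ p≤1 x∈p)) (∣⁅x⁆∣≡1 x)

AtMostOne⇒∣p∣≤1 : ∀ {n} (p : Subset n) → AtMostOne p → ∣ p ∣ ≤ 1
AtMostOne⇒∣p∣≤1 {n} p p≤1 with nonempty? p
... | yes (x , x∈p) = ≤-reflexive (AtMostOne⇒∣p∣≡1 p≤1 x∈p)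
... | no p-empty    = ≤-trans (≤-reflexive (trans (cong ∣_∣ (Empty-unique p-empty)) (∣⊥∣≡0 n))) z≤n

∣p∣≤1⇒AtMostOne : (p : Subset n) → ∣ p ∣ ≤ 1 → AtMostOne p
∣p∣≤1⇒AtMostOne p ∣p∣≤1 {x} {y} x∈p y∈p with y Fin.≟ x
... | yes y≡x = sym y≡x
... | no y≢x  = absurd (<⇒≱ (≤-trans (s≤s (x∈p⇒0<∣p∣ (x∈p∧x≢y⇒x∈p-y y∈p y≢x))) (x∈p⇒∣p-x∣<∣p∣ x∈p))
                              (≤-trans ∣p∣≤1 (s≤s z≤n)))

∃-between : ∀ (L U : Subset n) m → L ⊆ U → ∣ L ∣ ≤ m → m ≤ ∣ U ∣ →
  ∃ λ B → L ⊆ B × B ⊆ U × ∣ B ∣ ≡ m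
∃-between [] [] zero _ _ _ = [] , (λ ()) , (λ ()) , refl
∃-between (true ∷ L) (true ∷ U) (suc m) L⊆U (s≤s ∣L∣≤m) (s≤s m≤∣U∣) =
  let B , L⊆B , B⊆U , ∣B∣≡m = ∃-between L U m (drop-∷-⊆ L⊆U) ∣L∣≤m m≤∣U∣
  in true ∷ B , s⊆s L⊆B , s⊆s B⊆U , cong suc ∣B∣≡m
∃-between (true ∷ L) (false ∷ U) m L⊆U _ _ with L⊆U here
... | ()
∃-between (false ∷ L) (false ∷ U) m L⊆U ∣L∣≤m m≤∣U∣ =
  let B , L⊆B , B⊆U , ∣B∣≡m = ∃-between L U m (drop-∷-⊆ L⊆U) ∣L∣≤m m≤∣U∣
  in false ∷ B , s⊆s L⊆B , s⊆s B⊆U , ∣B∣≡m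
∃-between (false ∷ L) (true ∷ U) m L⊆U ∣L∣≤m m≤1+∣U∣ with m ≤? ∣ U ∣
... | yes m≤∣U∣ =
  let B , L⊆B , B⊆U , ∣B∣≡m = ∃-between L U m (drop-∷-⊆ L⊆U) ∣L∣≤m m≤∣U∣
  in false ∷ B , s⊆s L⊆B , out⊆ B⊆U , ∣B∣≡m
... | no m≰∣U∣ =
  let B , L⊆B , B⊆U , ∣B∣≡∣U∣ = ∃-between L U ∣ U ∣ (drop-∷-⊆ L⊆U) (p⊆q⇒∣p∣≤∣q∣ (drop-∷-⊆ L⊆U)) ≤-refl
  in true ∷ B , out⊆ L⊆B , s⊆s B⊆U , trans (cong suc ∣B∣≡∣U∣) (≤-antisym (≰⇒> m≰∣U∣) m≤1+∣U∣)

record Layer (n j : ℕ) : Set where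
  constructor layer
  field
    set  : Subset n
    size : ∣ set ∣ ≡ j

open Layer public

Layer-≡ : ∀ {j} {A B : Layer n j} → set A ≡ set B → A ≡ B
Layer-≡ {A = layer s p} {layer .s q} refl = cong (layer s) (≡-irrelevant p q)

layer-⊇-avoiding : ∀ {m} (T : Subset n) → x ∉ T → ∣ T ∣ ≤ m → m < n → Σ (Layer n m) λ B → T ⊆ set B × x ∉ set B
layer-⊇-avoiding {suc n} {x} {m} T x∉T ∣T∣≤m (s≤s m≤n-1) =
  let B , T⊆B , B⊆∁⁅x⁆ , ∣B∣≡m = ∃-between T (∁ ⁅ x ⁆) m T⊆∁⁅x⁆ ∣T∣≤m m≤∣∁⁅x⁆∣
  in layer B ∣B∣≡m , T⊆B , (λ x∈B → x∈∁p⇒x∉p (B⊆∁⁅x⁆ x∈B) (x∈⁅x⁆ x))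
  where
  T⊆∁⁅x⁆ : T ⊆ ∁ ⁅ x ⁆
  T⊆∁⁅x⁆ {y} y∈T = x∉p⇒x∈∁p (λ y∈⁅x⁆ → x∉T (subst (_∈ T) (x∈⁅y⁆⇒x≡y x y∈⁅x⁆) y∈T))
  m≤∣∁⁅x⁆∣ : m ≤ ∣ ∁ ⁅ x ⁆ ∣
  m≤∣∁⁅x⁆∣ = ≤-trans m≤n-1 (≤-reflexive (sym (trans (∣∁p∣≡n∸∣p∣ ⁅ x ⁆) (cong (suc n ∸_) (∣⁅x⁆∣≡1 x)))))

layer-⊇ : ∀ {m} (T : Subset n) → ∣ T ∣ ≤ m → m ≤ n → Σ (Layer n m) λ B → T ⊆ set B
layer-⊇ {n} {m} T ∣T∣≤m m≤n =
  let B , T⊆B , _ , ∣B∣≡m = ∃-between T ⊤ m ⊆⊤ ∣T∣≤m (≤-trans m≤n (≤-reflexive (sym (∣⊤∣≡n n))))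
  in layer B ∣B∣≡m , T⊆B

layer-⊆ : ∀ {m} (U : Subset n) → m ≤ ∣ U ∣ → Σ (Layer n m) λ B → set B ⊆ U
layer-⊆ {n} {m} U m≤∣U∣ =
  let B , _ , B⊆U , ∣B∣≡m = ∃-between ⊥ U m ⊥⊆ (≤-trans (≤-reflexive (∣⊥∣≡0 n)) z≤n) m≤∣U∣
  in layer B ∣B∣≡m , B⊆U

x∈p∪⁅y⁆⁻ : x ∈ p ∪ ⁅ y ⁆ → x ∈ p ⊎ x ≡ y
x∈p∪⁅y⁆⁻ {p = p} {y} x∈p∪⁅y⁆ with x∈p∪q⁻ p ⁅ y ⁆ x∈p∪⁅y⁆
... | inj₁ x∈p    = inj₁ x∈p
... | inj₂ x∈⁅y⁆ = inj₂ (x∈⁅y⁆⇒x≡y y x∈⁅y⁆)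

p⊆p∪⁅y⁆ : p ⊆ p ∪ ⁅ y ⁆
p⊆p∪⁅y⁆ {y = y} = p⊆p∪q ⁅ y ⁆

y∈p∪⁅y⁆ : y ∈ p ∪ ⁅ y ⁆
y∈p∪⁅y⁆ {y = y} {p = p} = q⊆p∪q p ⁅ y ⁆ (x∈⁅x⁆ y)

x∈p-y⁻ : x ∈ p - y → x ∈ p × x ≢ y
x∈p-y⁻ {p = p} {y} x∈p-y =
  let x∈p , x∉⁅y⁆ = x∈p─q⁻ p ⁅ y ⁆ x∈p-y in x∈p , x∉⁅y⁆⇒x≢y x∉⁅y⁆

∣p∪⁅y⁆∣≡1+∣p∣ : y ∉ p → ∣ p ∪ ⁅ y ⁆ ∣ ≡ suc ∣ p ∣
∣p∪⁅y⁆∣≡1+∣p∣ {y = y} {p} y∉p = begin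
  ∣ p ∪ ⁅ y ⁆ ∣         ≡⟨ ∣p∪q∣≡∣p∣+∣q─p∣ p ⁅ y ⁆ ⟩
  ∣ p ∣ + ∣ ⁅ y ⁆ ─ p ∣ ≡⟨ cong (λ s → ∣ p ∣ + ∣ s ∣) ⁅y⁆─p≡⁅y⁆ ⟩
  ∣ p ∣ + ∣ ⁅ y ⁆ ∣     ≡⟨ cong (∣ p ∣ +_) (∣⁅x⁆∣≡1 y) ⟩
  ∣ p ∣ + 1             ≡⟨ +-comm ∣ p ∣ 1 ⟩
  suc ∣ p ∣             ∎
  where
  open ≡-Reasoning
  ⁅y⁆─p≡⁅y⁆ : ⁅ y ⁆ ─ p ≡ ⁅ y ⁆
  ⁅y⁆─p≡⁅y⁆ = ⊆-antisym (p─q⊆p ⁅ y ⁆ p)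
    (λ x∈⁅y⁆ → x∈p∧x∉q⇒x∈p─q x∈⁅y⁆ (λ x∈p → y∉p (subst (_∈ p) (x∈⁅y⁆⇒x≡y y x∈⁅y⁆) x∈p)))

1+∣p-x∣≡∣p∣ : x ∈ p → suc ∣ p - x ∣ ≡ ∣ p ∣
1+∣p-x∣≡∣p∣ {x = x} {p} x∈p = sym (begin
  ∣ p ∣                     ≡⟨ ∣p∣≡∣p∩q∣+∣p─q∣ p ⁅ x ⁆ ⟩
  ∣ p ∩ ⁅ x ⁆ ∣ + ∣ p - x ∣ ≡⟨ cong (λ s → ∣ s ∣ + ∣ p - x ∣) p∩⁅x⁆≡⁅x⁆ ⟩
  ∣ ⁅ x ⁆ ∣ + ∣ p - x ∣     ≡⟨ cong (_+ ∣ p - x ∣) (∣⁅x⁆∣≡1 x) ⟩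
  suc ∣ p - x ∣             ∎)
  where
  open ≡-Reasoning
  p∩⁅x⁆≡⁅x⁆ : p ∩ ⁅ x ⁆ ≡ ⁅ x ⁆
  p∩⁅x⁆≡⁅x⁆ = ⊆-antisym (p∩q⊆q p ⁅ x ⁆)
    (λ y∈⁅x⁆ → x∈p∩q⁺ (subst (_∈ p) (sym (x∈⁅y⁆⇒x≡y x y∈⁅x⁆)) x∈p , y∈⁅x⁆))

∣p-x∪⁅y⁆∣≡∣p∣ : x ∈ p → y ∉ p → ∣ (p - x) ∪ ⁅ y ⁆ ∣ ≡ ∣ p ∣
∣p-x∪⁅y⁆∣≡∣p∣ {x = x} {p} {y} x∈p y∉p =
  trans (∣p∪⁅y⁆∣≡1+∣p∣ {y = y} {p - x} (λ y∈p-x → y∉p (proj₁ (x∈p-y⁻ y∈p-x)))) (1+∣p-x∣≡∣p∣ x∈p)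

-- Covers and Johnson adjacency

exchange : ∀ {j} (A : Layer n j) → x ∈ set A → y ∉ set A → Layer n j
exchange {x = x} {y} A x∈A y∉A = layer ((set A - x) ∪ ⁅ y ⁆) (trans (∣p-x∪⁅y⁆∣≡∣p∣ x∈A y∉A) (size A))

module _ {j} (A : Layer n j) (x∈A : x ∈ set A) (y∉A : y ∉ set A) where

  exchange⊆∪⁅⁆ : set (exchange A x∈A y∉A) ⊆ set A ∪ ⁅ y ⁆
  exchange⊆∪⁅⁆ z∈ = [ (λ z∈A-x → p⊆p∪⁅y⁆ (proj₁ (x∈p-y⁻ z∈A-x))) , (λ z≡y → subst (_∈ set A ∪ ⁅ y ⁆) (sym z≡y) y∈p∪⁅y⁆) ]
                      (x∈p∪⁅y⁆⁻ z∈)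

  y∈exchange : y ∈ set (exchange A x∈A y∉A)
  y∈exchange = y∈p∪⁅y⁆

  exchange─⊆ : ∀ {S} → y ∈ S → set (exchange A x∈A y∉A) ─ S ⊆ (set A ─ S) - x
  exchange─⊆ {S} y∈S z∈ with x∈p─q⁻ _ S z∈
  ... | z∈A′ , z∉S = [ (λ z∈A-x → let z∈A , z≢x = x∈p-y⁻ z∈A-x in x∈p∧x≢y⇒x∈p-y (x∈p∧x∉q⇒x∈p─q z∈A z∉S) z≢x)
                     , (λ z≡y → absurd (z∉S (subst (_∈ S) (sym z≡y) y∈S))) ] (x∈p∪⁅y⁆⁻ z∈A′)

infix 4 _⋖_
_⋖_ : Subset n → Subset n → Set
C ⋖ P = C ⊆ P × ∣ P ∣ ≡ suc ∣ C ∣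

Johnson : Subset n → Subset n → Set
Johnson A B = A ≢ B × AtMostOne (B ─ A) × AtMostOne (A ─ B)

⋖⇒AtMostOne─ : ∀ {C P : Subset n} → C ⋖ P → AtMostOne (P ─ C)
⋖⇒AtMostOne─ {C = C} {P} (C⊆P , ∣P∣≡1+∣C∣) = ∣p∣≤1⇒AtMostOne (P ─ C) (≤-reflexive ∣P─C∣≡1)
  where
  ∣P─C∣≡1 : ∣ P ─ C ∣ ≡ 1
  ∣P─C∣≡1 = +-cancelˡ-≡ ∣ C ∣ _ _ (begin
    ∣ C ∣ + ∣ P ─ C ∣     ≡⟨ cong (λ s → ∣ s ∣ + ∣ P ─ C ∣) (⊆-antisym (p∩q⊆q P C) (λ x∈C → x∈p∩q⁺ (C⊆P x∈C , x∈C))) ⟨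
    ∣ P ∩ C ∣ + ∣ P ─ C ∣ ≡⟨ ∣p∣≡∣p∩q∣+∣p─q∣ P C ⟨
    ∣ P ∣                 ≡⟨ ∣P∣≡1+∣C∣ ⟩
    suc ∣ C ∣             ≡⟨ +-comm 1 ∣ C ∣ ⟩
    ∣ C ∣ + 1             ∎)
    where open ≡-Reasoning

AtMostOne─-swap : ∀ {A B : Subset n} → ∣ A ∣ ≡ ∣ B ∣ → AtMostOne (B ─ A) → AtMostOne (A ─ B)
AtMostOne─-swap {A = A} {B} ∣A∣≡∣B∣ B─A≤1 =
  ∣p∣≤1⇒AtMostOne (A ─ B) (≤-trans (≤-reflexive ∣A─B∣≡∣B─A∣) (AtMostOne⇒∣p∣≤1 (B ─ A) B─A≤1))
  where
  ∣A─B∣≡∣B─A∣ : ∣ A ─ B ∣ ≡ ∣ B ─ A ∣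
  ∣A─B∣≡∣B─A∣ = +-cancelˡ-≡ ∣ A ∩ B ∣ _ _ (begin
    ∣ A ∩ B ∣ + ∣ A ─ B ∣ ≡⟨ ∣p∣≡∣p∩q∣+∣p─q∣ A B ⟨
    ∣ A ∣                 ≡⟨ ∣A∣≡∣B∣ ⟩
    ∣ B ∣                 ≡⟨ ∣p∣≡∣p∩q∣+∣p─q∣ B A ⟩
    ∣ B ∩ A ∣ + ∣ B ─ A ∣ ≡⟨ cong (λ s → ∣ s ∣ + ∣ B ─ A ∣) (∩-comm B A) ⟩
    ∣ A ∩ B ∣ + ∣ B ─ A ∣ ∎)
    where open ≡-Reasoning

⋖∧⋖⇒∩⊆ : ∀ {C P Q : Subset n} → C ⋖ P → C ⋖ Q → P ≢ Q → ∀ {x} → x ∈ P ∩ Q → x ∈ C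
⋖∧⋖⇒∩⊆ {C = C} {P} {Q} C⋖P@(C⊆P , ∣P∣≡1+∣C∣) (C⊆Q , ∣Q∣≡1+∣C∣) P≢Q {x} x∈P∩Q with x ∈? C
... | yes x∈C = x∈C
... | no x∉C = absurd (P≢Q (p⊆q∧∣q∣≤∣p∣⇒p≡q P⊆Q (≤-reflexive (trans ∣Q∣≡1+∣C∣ (sym ∣P∣≡1+∣C∣)))))
  where
  x∈P : x ∈ P
  x∈P = proj₁ (x∈p∩q⁻ P Q x∈P∩Q)
  x∈Q : x ∈ Q
  x∈Q = proj₂ (x∈p∩q⁻ P Q x∈P∩Q)
  P⊆Q : P ⊆ Q
  P⊆Q {y} y∈P with y ∈? C
  ... | yes y∈C = C⊆Q y∈C
  ... | no y∉C  = subst (_∈ Q) (⋖⇒AtMostOne─ C⋖P (x∈p∧x∉q⇒x∈p─q x∈P x∉C) (x∈p∧x∉q⇒x∈p─q y∈P y∉C)) x∈Q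

⋖∧⋖⇒∉ : ∀ {C P R : Subset n} → C ⋖ P → C ⋖ R → P ≢ R → x ∈ R → x ∉ C → x ∉ P
⋖∧⋖⇒∉ C⋖P C⋖R P≢R x∈R x∉C x∈P = x∉C (⋖∧⋖⇒∩⊆ C⋖P C⋖R P≢R (x∈p∩q⁺ (x∈P , x∈R)))

⋖⇒∃∈─ : ∀ {C P : Subset n} → C ⋖ P → ∃ λ x → x ∈ P × x ∉ C
⋖⇒∃∈─ (C⊆P , ∣P∣≡1+∣C∣) = ∣p∣≤∣q∣⇒∃∈q─p (≤-trans (n≤1+n _) (≤-reflexive (sym ∣P∣≡1+∣C∣)))
  (λ C≡P → 1+n≢n (trans (sym ∣P∣≡1+∣C∣) (cong ∣_∣ (sym C≡P))))

⋖∧⋖⇒∩≡ : ∀ {C P Q : Subset n} → C ⋖ P → C ⋖ Q → P ≢ Q → P ∩ Q ≡ C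
⋖∧⋖⇒∩≡ C⋖P C⋖Q P≢Q = ⊆-antisym (⋖∧⋖⇒∩⊆ C⋖P C⋖Q P≢Q) (λ x∈C → x∈p∩q⁺ (proj₁ C⋖P x∈C , proj₁ C⋖Q x∈C))

⋖∧⋖⇒Johnson : ∀ {C P Q : Subset n} → C ⋖ P → C ⋖ Q → P ≢ Q → Johnson P Q
⋖∧⋖⇒Johnson {C = C} C⋖P C⋖Q P≢Q = P≢Q , ─-AtMostOne C⋖P C⋖Q , ─-AtMostOne C⋖Q C⋖P
  where
  ─-AtMostOne : ∀ {P Q} → C ⋖ P → C ⋖ Q → AtMostOne (Q ─ P)
  ─-AtMostOne {P} {Q} (C⊆P , _) C⋖Q x∈Q─P y∈Q─P = ⋖⇒AtMostOne─ C⋖Q (shrink x∈Q─P) (shrink y∈Q─P)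
    where
    shrink : ∀ {x} → x ∈ Q ─ P → x ∈ Q ─ C
    shrink x∈Q─P = let x∈Q , x∉P = x∈p─q⁻ Q P x∈Q─P in x∈p∧x∉q⇒x∈p─q x∈Q (λ x∈C → x∉P (C⊆P x∈C))

Johnson⇒∩⋖ : ∀ {P Q : Subset n} → ∣ P ∣ ≡ ∣ Q ∣ → Johnson P Q → P ∩ Q ⋖ P
Johnson⇒∩⋖ {P = P} {Q} ∣P∣≡∣Q∣ (P≢Q , _ , P─Q≤1) =
  let x , x∈P , x∉Q = ∣p∣≤∣q∣⇒∃∈q─p (≤-reflexive (sym ∣P∣≡∣Q∣)) (λ Q≡P → P≢Q (sym Q≡P))
  in p∩q⊆p P Q , (begin
    ∣ P ∣                     ≡⟨ ∣p∣≡∣p∩q∣+∣p─q∣ P Q ⟩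
    ∣ P ∩ Q ∣ + ∣ P ─ Q ∣     ≡⟨ cong (∣ P ∩ Q ∣ +_) (AtMostOne⇒∣p∣≡1 P─Q≤1 (x∈p∧x∉q⇒x∈p─q x∈P x∉Q)) ⟩
    ∣ P ∩ Q ∣ + 1             ≡⟨ +-comm _ 1 ⟩
    suc ∣ P ∩ Q ∣             ∎)
  where open ≡-Reasoning

-- Triangles of the Johnson graph through an edge PQ are of two kinds: R ⊆ P ∪ Q, or R ⊇ P ∩ Q.
Johnson-triangle : ∀ {P Q R : Subset n} → ∣ P ∣ ≡ ∣ Q ∣ → P ≢ Q → AtMostOne (R ─ P) → AtMostOne (Q ─ R) →
  ¬ (R ⊆ P ∪ Q) → P ∩ Q ⊆ R
Johnson-triangle {P = P} {Q} {R} ∣P∣≡∣Q∣ P≢Q R─P≤1 Q─R≤1 R⊈P∪Q {c} c∈P∩Q with c ∈? R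
... | yes c∈R = c∈R
... | no c∉R = absurd (R⊈P∪Q R⊆P∪Q)
  where
  c∈P : c ∈ P
  c∈P = proj₁ (x∈p∩q⁻ P Q c∈P∩Q)
  c∈Q : c ∈ Q
  c∈Q = proj₂ (x∈p∩q⁻ P Q c∈P∩Q)
  R⊆P∪Q : R ⊆ P ∪ Q
  R⊆P∪Q {r} r∈R with r ∈? P | r ∈? Q
  ... | yes r∈P | _       = x∈p∪q⁺ (inj₁ r∈P)
  ... | no _    | yes r∈Q = x∈p∪q⁺ (inj₂ r∈Q)
  ... | no r∉P  | no r∉Q  = absurd (P≢Q (sym (p⊆q∧∣q∣≤∣p∣⇒p≡q Q⊆P (≤-reflexive ∣P∣≡∣Q∣))))
    where
    Q⊆P : Q ⊆ P
    Q⊆P {q} q∈Q with q ∈? R | q ∈? P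
    ... | no q∉R  | _       = subst (_∈ P) (Q─R≤1 (x∈p∧x∉q⇒x∈p─q c∈Q c∉R) (x∈p∧x∉q⇒x∈p─q q∈Q q∉R)) c∈P
    ... | yes _   | yes q∈P = q∈P
    ... | yes q∈R | no q∉P  = absurd (r∉Q (subst (_∈ Q) (R─P≤1 (x∈p∧x∉q⇒x∈p─q q∈R q∉P) (x∈p∧x∉q⇒x∈p─q r∈R r∉P)) q∈Q))

-- Layers of the Boolean lattice and inclusion-preserving bijections between them

record Levels (n j m : ℕ) : Set where
  field
    1≤j : 1 ≤ j
    j<m : j < m
    m<n : m < n

record LayerIso (n j m j′ m′ : ℕ) : Set where
  field
    low         : Layer n j → Layer n j′
    low⁻¹       : Layer n j′ → Layer n j
    high        : Layer n m → Layer n m′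
    high⁻¹      : Layer n m′ → Layer n m
    low⁻¹∘low   : ∀ A → low⁻¹ (low A) ≡ A
    low∘low⁻¹   : ∀ A → low (low⁻¹ A) ≡ A
    high⁻¹∘high : ∀ B → high⁻¹ (high B) ≡ B
    high∘high⁻¹ : ∀ B → high (high⁻¹ B) ≡ B
    ⊆-preserve  : ∀ A B → set A ⊆ set B → set (low A) ⊆ set (high B)
    ⊆-reflect   : ∀ A B → set (low A) ⊆ set (high B) → set A ⊆ set B

  low-injective : ∀ {A A′} → set (low A) ≡ set (low A′) → set A ≡ set A′
  low-injective {A} {A′} e = cong set (begin
    A               ≡⟨ low⁻¹∘low A ⟨
    low⁻¹ (low A)   ≡⟨ cong low⁻¹ (Layer-≡ e) ⟩
    low⁻¹ (low A′)  ≡⟨ low⁻¹∘low A′ ⟩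
    A′              ∎)
    where open ≡-Reasoning

  low⊆⇒⊆high⁻¹ : ∀ A B′ → set (low A) ⊆ set B′ → set A ⊆ set (high⁻¹ B′)
  low⊆⇒⊆high⁻¹ A B′ A⊆B′ = ⊆-reflect A (high⁻¹ B′) (subst (λ B → set (low A) ⊆ set B) (sym (high∘high⁻¹ B′)) A⊆B′)

  ⊆high⁻¹⇒low⊆ : ∀ A B′ → set A ⊆ set (high⁻¹ B′) → set (low A) ⊆ set B′
  ⊆high⁻¹⇒low⊆ A B′ A⊆B = subst (λ B → set (low A) ⊆ set B) (high∘high⁻¹ B′) (⊆-preserve A (high⁻¹ B′) A⊆B)

open LayerIso public

LayerIso-sym : ∀ {j m j′ m′} → LayerIso n j m j′ m′ → LayerIso n j′ m′ j m
LayerIso-sym Φ = record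
  { low = low⁻¹ Φ ; low⁻¹ = low Φ ; high = high⁻¹ Φ ; high⁻¹ = high Φ
  ; low⁻¹∘low = low∘low⁻¹ Φ ; low∘low⁻¹ = low⁻¹∘low Φ
  ; high⁻¹∘high = high∘high⁻¹ Φ ; high∘high⁻¹ = high⁻¹∘high Φ
  ; ⊆-preserve = λ A′ B′ A′⊆B′ → low⊆⇒⊆high⁻¹ Φ (low⁻¹ Φ A′) B′ (subst (λ A → set A ⊆ set B′) (sym (low∘low⁻¹ Φ A′)) A′⊆B′)
  ; ⊆-reflect = λ A′ B′ A⊆B → subst (λ A → set A ⊆ set B′) (low∘low⁻¹ Φ A′) (⊆high⁻¹⇒low⊆ Φ (low⁻¹ Φ A′) B′ A⊆B)
  }

Forces : ℕ → Subset n → Subset n → Subset n → Set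
Forces {n} m A A′ X = (B : Layer n m) → A ⊆ set B → A′ ⊆ set B → X ⊆ set B

⊆∪⇒Forces : ∀ {m} {A A′ X : Subset n} → X ⊆ A ∪ A′ → Forces m A A′ X
⊆∪⇒Forces {A = A} {A′} X⊆A∪A′ B A⊆B A′⊆B x∈X with x∈p∪q⁻ A A′ (X⊆A∪A′ x∈X)
... | inj₁ x∈A  = A⊆B x∈A
... | inj₂ x∈A′ = A′⊆B x∈A′

-- Johnson adjacency of j-sets rephrased through inclusions of j-sets in m-sets only,
-- so that layer isomorphisms transport it.
LayerJohnson : ℕ → ℕ → Subset n → Subset n → Set
LayerJohnson {n} j m A A′ =
  A ≢ A′ × ((X : Layer n j) → Forces m A A′ (set X) → set X ≢ A → Forces m A (set X) A′)

module _ {j m j′ m′} (Φ : LayerIso n j m j′ m′) where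

  Forces-transport : ∀ A A′ X → Forces m (set A) (set A′) (set X) →
    Forces m′ (set (low Φ A)) (set (low Φ A′)) (set (low Φ X))
  Forces-transport A A′ X forces B′ A⊆B′ A′⊆B′ = ⊆high⁻¹⇒low⊆ Φ X B′
    (forces (high⁻¹ Φ B′) (low⊆⇒⊆high⁻¹ Φ A B′ A⊆B′) (low⊆⇒⊆high⁻¹ Φ A′ B′ A′⊆B′))

  Forces-reflect : ∀ A A′ X → Forces m′ (set (low Φ A)) (set (low Φ A′)) (set (low Φ X)) →
    Forces m (set A) (set A′) (set X)
  Forces-reflect A A′ X forces B A⊆B A′⊆B = ⊆-reflect Φ X B
    (forces (high Φ B) (⊆-preserve Φ A B A⊆B) (⊆-preserve Φ A′ B A′⊆B))

  LayerJohnson-transport : ∀ A A′ → LayerJohnson j m (set A) (set A′) →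
    LayerJohnson j′ m′ (set (low Φ A)) (set (low Φ A′))
  LayerJohnson-transport A A′ (A≢A′ , closed) =
    A≢A′ ∘′ low-injective Φ , λ X′ → subst P (low∘low⁻¹ Φ X′) (closedˡ (low⁻¹ Φ X′))
    where
    P : Layer n j′ → Set
    P X′ = Forces m′ (set (low Φ A)) (set (low Φ A′)) (set X′) → set X′ ≢ set (low Φ A) →
           Forces m′ (set (low Φ A)) (set X′) (set (low Φ A′))
    closedˡ : ∀ X → P (low Φ X)
    closedˡ X forces X′≢A′ = Forces-transport A X A′
      (closed X (Forces-reflect A A′ X forces) (λ X≡A → X′≢A′ (cong (set ∘′ low Φ) (Layer-≡ X≡A))))

  LayerJohnson-reflect : ∀ A A′ → LayerJohnson j′ m′ (set (low Φ A)) (set (low Φ A′)) →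
    LayerJohnson j m (set A) (set A′)
  LayerJohnson-reflect A A′ (A≢A′ , closed) = (λ A≡A′ → A≢A′ (cong (set ∘′ low Φ) (Layer-≡ A≡A′))) , closedˡ
    where
    closedˡ : ∀ X → Forces m (set A) (set A′) (set X) → set X ≢ set A → Forces m (set A) (set X) (set A′)
    closedˡ X forces X≢A = Forces-reflect A X A′
      (closed (low Φ X) (Forces-transport A A′ X forces) (X≢A ∘′ low-injective Φ))

AtMostOne─⇒⊆∪⁅⁆ : ∀ {A A′ : Subset n} → AtMostOne (A′ ─ A) → y ∈ A′ → y ∉ A → A′ ⊆ A ∪ ⁅ y ⁆
AtMostOne─⇒⊆∪⁅⁆ {A = A} {A′} A′─A≤1 y∈A′ y∉A {z} z∈A′ with z ∈? A
... | yes z∈A = p⊆p∪⁅y⁆ z∈A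
... | no z∉A  = subst (_∈ A ∪ ⁅ _ ⁆) (A′─A≤1 (x∈p∧x∉q⇒x∈p─q y∈A′ y∉A) (x∈p∧x∉q⇒x∈p─q z∈A′ z∉A)) y∈p∪⁅y⁆

module _ {j m} (levels : Levels n j m) where
  open Levels levels

  Forces⇒⊆ : ∀ {A A′ X} → Forces m A A′ X → (T : Subset n) → A ⊆ T → A′ ⊆ T → ∣ T ∣ ≤ m → X ⊆ T
  Forces⇒⊆ forces T A⊆T A′⊆T ∣T∣≤m {x} x∈X with x ∈? T
  ... | yes x∈T = x∈T
  ... | no x∉T =
    let B , T⊆B , x∉B = layer-⊇-avoiding T x∉T ∣T∣≤m m<n
    in absurd (x∉B (forces B (T⊆B ∘′ A⊆T) (T⊆B ∘′ A′⊆T) x∈X))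

  ∣A∪⁅y⁆∣≤m : ∀ {A : Subset n} → ∣ A ∣ ≡ j → y ∉ A → ∣ A ∪ ⁅ y ⁆ ∣ ≤ m
  ∣A∪⁅y⁆∣≤m ∣A∣≡j y∉A = ≤-trans (≤-reflexive (trans (∣p∪⁅y⁆∣≡1+∣p∣ y∉A) (cong suc ∣A∣≡j))) j<m

  -- If A′ = A − a + b then the j-sets other than A forced by A and A′ are those
  -- containing b, and each of them forces A′ together with A.
  Johnson⇒LayerJohnson : (A A′ : Layer n j) → Johnson (set A) (set A′) → LayerJohnson j m (set A) (set A′)
  Johnson⇒LayerJohnson A A′ (A≢A′ , A′─A≤1 , _) with ∣p∣≤∣q∣⇒∃∈q─p (≤-reflexive (trans (size A) (sym (size A′)))) A≢A′
  ... | b , b∈A′ , b∉A = A≢A′ , closed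
    where
    A′⊆A∪⁅b⁆ : set A′ ⊆ set A ∪ ⁅ b ⁆
    A′⊆A∪⁅b⁆ = AtMostOne─⇒⊆∪⁅⁆ A′─A≤1 b∈A′ b∉A
    closed : (X : Layer n j) → Forces m (set A) (set A′) (set X) → set X ≢ set A → Forces m (set A) (set X) (set A′)
    closed X forces X≢A B A⊆B X⊆B z∈A′
      with x∈p∪⁅y⁆⁻ (A′⊆A∪⁅b⁆ z∈A′) | ∣p∣≤∣q∣⇒∃∈q─p (≤-reflexive (trans (size A) (sym (size X)))) (X≢A ∘′ sym)
    ... | inj₁ z∈A  | _ = A⊆B z∈A
    ... | inj₂ refl | x , x∈X , x∉A
      with x∈p∪⁅y⁆⁻ (Forces⇒⊆ forces (set A ∪ ⁅ b ⁆) p⊆p∪⁅y⁆ A′⊆A∪⁅b⁆ (∣A∪⁅y⁆∣≤m (size A) b∉A) x∈X)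
    ...   | inj₁ x∈A  = absurd (x∉A x∈A)
    ...   | inj₂ refl = X⊆B x∈X

  -- If A′ ─ A contained y ≠ z, then X = A − a + y would be forced by A and A′, while
  -- an m-set through A ∪ {y} avoiding z shows that A and X do not force A′.
  LayerJohnson⇒Johnson : (A A′ : Layer n j) → LayerJohnson j m (set A) (set A′) → Johnson (set A) (set A′)
  LayerJohnson⇒Johnson A A′ (A≢A′ , closed) = A≢A′ , A′─A≤1 , AtMostOne─-swap (trans (size A) (sym (size A′))) A′─A≤1
    where
    a∈A : Nonempty (set A)
    a∈A = 0<∣p∣⇒Nonempty (set A) (≤-trans 1≤j (≤-reflexive (sym (size A))))
    A′─A≤1 : AtMostOne (set A′ ─ set A)
    A′─A≤1 {y} {z} y∈A′─A z∈A′─A with z Fin.≟ y | x∈p─q⁻ (set A′) (set A) y∈A′─A | x∈p─q⁻ (set A′) (set A) z∈A′─A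
    ... | yes z≡y | _ | _ = sym z≡y
    ... | no z≢y | y∈A′ , y∉A | z∈A′ , z∉A
      with layer-⊇-avoiding (set A ∪ ⁅ y ⁆) ([ z∉A , z≢y ] ∘′ x∈p∪⁅y⁆⁻) (∣A∪⁅y⁆∣≤m (size A) y∉A) m<n
    ...   | B , A∪y⊆B , z∉B =
      absurd (z∉B (closed X X-forced X≢A B (A∪y⊆B ∘′ p⊆p∪⁅y⁆) (A∪y⊆B ∘′ exchange⊆∪⁅⁆ A (proj₂ a∈A) y∉A) z∈A′))
      where
      X : Layer n j
      X = exchange A (proj₂ a∈A) y∉A
      X-forced : Forces m (set A) (set A′) (set X)
      X-forced = ⊆∪⇒Forces λ x∈X →
        [ (λ x∈A → x∈p∪q⁺ (inj₁ x∈A)) , (λ x≡y → x∈p∪q⁺ (inj₂ (subst (_∈ set A′) (sym x≡y) y∈A′))) ]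
        (x∈p∪⁅y⁆⁻ (exchange⊆∪⁅⁆ A (proj₂ a∈A) y∉A x∈X))
      X≢A : set X ≢ set A
      X≢A X≡A = y∉A (subst (y ∈_) X≡A (y∈exchange A (proj₂ a∈A) y∉A))

  ⋖-triple⇒¬Forces : ∀ {C P Q R : Subset n} → C ⋖ P → C ⋖ Q → C ⋖ R → ∣ P ∣ ≡ j →
    P ≢ Q → P ≢ R → Q ≢ R → ¬ Forces m P Q R
  ⋖-triple⇒¬Forces {C} {P} {Q} {R} C⋖P C⋖Q C⋖R ∣P∣≡j P≢Q P≢R Q≢R forces
    with ⋖⇒∃∈─ C⋖R | ∣p∣≤∣q∣⇒∃∈q─p (≤-reflexive (trans (proj₂ C⋖P) (sym (proj₂ C⋖Q)))) P≢Q
  ... | r , r∈R , r∉C | t , t∈Q , t∉P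
    with layer-⊇-avoiding (P ∪ ⁅ t ⁆) r∉P∪⁅t⁆ (∣A∪⁅y⁆∣≤m ∣P∣≡j t∉P) m<n
    where
    r∉P∪⁅t⁆ : r ∉ P ∪ ⁅ t ⁆
    r∉P∪⁅t⁆ r∈ = [ ⋖∧⋖⇒∉ C⋖P C⋖R P≢R r∈R r∉C
                 , (λ r≡t → ⋖∧⋖⇒∉ C⋖Q C⋖R Q≢R r∈R r∉C (subst (_∈ Q) (sym r≡t) t∈Q)) ] (x∈p∪⁅y⁆⁻ r∈)
  ...   | B , P∪t⊆B , r∉B =
    r∉B (forces B (P∪t⊆B ∘′ p⊆p∪⁅y⁆) (P∪t⊆B ∘′ AtMostOne─⇒⊆∪⁅⁆ (proj₁ (proj₂ (⋖∧⋖⇒Johnson C⋖P C⋖Q P≢Q))) t∈Q t∉P) r∈R)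

module _ {j m j′ m′} (Φ : LayerIso n j m j′ m′) (levels : Levels n j m) (levels′ : Levels n j′ m′) where

  Johnson-transport : ∀ A A′ → Johnson (set A) (set A′) → Johnson (set (low Φ A)) (set (low Φ A′))
  Johnson-transport A A′ =
    LayerJohnson⇒Johnson levels′ (low Φ A) (low Φ A′) ∘′ LayerJohnson-transport Φ A A′ ∘′ Johnson⇒LayerJohnson levels A A′

  Johnson-reflect : ∀ A A′ → Johnson (set (low Φ A)) (set (low Φ A′)) → Johnson (set A) (set A′)
  Johnson-reflect A A′ =
    LayerJohnson⇒Johnson levels A A′ ∘′ LayerJohnson-reflect Φ A A′ ∘′ Johnson⇒LayerJohnson levels′ (low Φ A) (low Φ A′)

-- Descending to the layer below

_≟ₛ_ : (p q : Subset n) → Dec (p ≡ q)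
_≟ₛ_ = Vec.≡-dec Bool._≟_

1<∣p∣⇒∃-distinct : (p : Subset n) → 1 < ∣ p ∣ → ∃ λ x → ∃ λ y → x ∈ p × y ∈ p × x ≢ y
1<∣p∣⇒∃-distinct p 1<∣p∣ =
  let x , x∈p = 0<∣p∣⇒Nonempty p (≤-trans (s≤s z≤n) 1<∣p∣)
      y , y∈p-x = 0<∣p∣⇒Nonempty (p - x) (≤-pred (≤-trans 1<∣p∣ (≤-reflexive (sym (1+∣p-x∣≡∣p∣ x∈p)))))
      y∈p , y≢x = x∈p-y⁻ y∈p-x
  in x , y , x∈p , y∈p , y≢x ∘′ sym

⊆⇒⋖ : ∀ {i} (C : Layer n i) (P : Layer n (suc i)) → set C ⊆ set P → set C ⋖ set P
⊆⇒⋖ C P C⊆P = C⊆P , trans (size P) (cong suc (sym (size C)))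

module Star {i m i′ m′} (Φ : LayerIso n (suc i) m (suc i′) m′)
            (levels : Levels n (suc i) m) (levels′ : Levels n (suc i′) m′) where

  -- Images of distinct covers of C never lie in the union of two others (⋖-triple⇒¬Forces),
  -- so by Johnson-triangle they all contain the same intersection.
  image-∩⊆ : (C : Layer n i) (P Q R : Layer n (suc i)) → set C ⊆ set P → set C ⊆ set Q → set C ⊆ set R →
    set P ≢ set Q → set (low Φ P) ∩ set (low Φ Q) ⊆ set (low Φ R)
  image-∩⊆ C P Q R C⊆P C⊆Q C⊆R P≢Q with set R ≟ₛ set P | set R ≟ₛ set Q
  ... | yes R≡P | _       = subst (λ S → _ ⊆ set (low Φ S)) (Layer-≡ (sym R≡P)) (p∩q⊆p _ _)
  ... | no _    | yes R≡Q = subst (λ S → _ ⊆ set (low Φ S)) (Layer-≡ (sym R≡Q)) (p∩q⊆q _ _)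
  ... | no R≢P  | no R≢Q  = Johnson-triangle (trans (size (low Φ P)) (sym (size (low Φ Q)))) (P≢Q ∘′ low-injective Φ)
                              (proj₁ (proj₂ P~R)) (proj₁ (proj₂ R~Q)) lowR⊈
    where
    P~R : Johnson (set (low Φ P)) (set (low Φ R))
    P~R = Johnson-transport Φ levels levels′ P R (⋖∧⋖⇒Johnson (⊆⇒⋖ C P C⊆P) (⊆⇒⋖ C R C⊆R) (R≢P ∘′ sym))
    R~Q : Johnson (set (low Φ R)) (set (low Φ Q))
    R~Q = Johnson-transport Φ levels levels′ R Q (⋖∧⋖⇒Johnson (⊆⇒⋖ C R C⊆R) (⊆⇒⋖ C Q C⊆Q) R≢Q)
    lowR⊈ : ¬ (set (low Φ R) ⊆ set (low Φ P) ∪ set (low Φ Q))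
    lowR⊈ lowR⊆ = ⋖-triple⇒¬Forces levels (⊆⇒⋖ C P C⊆P) (⊆⇒⋖ C Q C⊆Q) (⊆⇒⋖ C R C⊆R) (size P)
      P≢Q (R≢P ∘′ sym) (R≢Q ∘′ sym) (Forces-reflect Φ P Q R (⊆∪⇒Forces lowR⊆))

  module Covers (C : Layer n i) where
    open Levels levels

    1<∣∁C∣ : 1 < ∣ ∁ (set C) ∣
    1<∣∁C∣ = ≤-trans (m+n≤o⇒m≤o∸n 2 (≤-trans j<m (<⇒≤ m<n)))
                     (≤-reflexive (sym (trans (∣∁p∣≡n∸∣p∣ (set C)) (cong (n ∸_) (size C)))))

    fresh : ∃ λ a → ∃ λ b → a ∈ ∁ (set C) × b ∈ ∁ (set C) × a ≢ b
    fresh = 1<∣p∣⇒∃-distinct (∁ (set C)) 1<∣∁C∣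

    a b : Fin n
    a = proj₁ fresh
    b = proj₁ (proj₂ fresh)

    a∉C : a ∉ set C
    a∉C = x∈∁p⇒x∉p (proj₁ (proj₂ (proj₂ fresh)))
    b∉C : b ∉ set C
    b∉C = x∈∁p⇒x∉p (proj₁ (proj₂ (proj₂ (proj₂ fresh))))

    P₀ Q₀ : Layer n (suc i)
    P₀ = layer (set C ∪ ⁅ a ⁆) (trans (∣p∪⁅y⁆∣≡1+∣p∣ a∉C) (cong suc (size C)))
    Q₀ = layer (set C ∪ ⁅ b ⁆) (trans (∣p∪⁅y⁆∣≡1+∣p∣ b∉C) (cong suc (size C)))

    C⊆P₀ : set C ⊆ set P₀
    C⊆P₀ = p⊆p∪⁅y⁆
    C⊆Q₀ : set C ⊆ set Q₀
    C⊆Q₀ = p⊆p∪⁅y⁆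

    P₀≢Q₀ : set P₀ ≢ set Q₀
    P₀≢Q₀ P₀≡Q₀ = [ a∉C , proj₂ (proj₂ (proj₂ (proj₂ fresh))) ] (x∈p∪⁅y⁆⁻ (subst (a ∈_) P₀≡Q₀ y∈p∪⁅y⁆))

  -- The map induced on i-sets: by meet-unique, any two distinct covers of C may be used.
  meet : Layer n i → Layer n i′
  meet C = layer (set (low Φ P₀) ∩ set (low Φ Q₀)) (suc-injective (trans (sym (proj₂ ∩⋖)) (size (low Φ P₀))))
    where
    open Covers C
    ∩⋖ : set (low Φ P₀) ∩ set (low Φ Q₀) ⋖ set (low Φ P₀)
    ∩⋖ = Johnson⇒∩⋖ (trans (size (low Φ P₀)) (sym (size (low Φ Q₀))))
           (Johnson-transport Φ levels levels′ P₀ Q₀ (⋖∧⋖⇒Johnson (⊆⇒⋖ C P₀ C⊆P₀) (⊆⇒⋖ C Q₀ C⊆Q₀) P₀≢Q₀))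

  meet⊆low : ∀ C A → set C ⊆ set A → set (meet C) ⊆ set (low Φ A)
  meet⊆low C A C⊆A = image-∩⊆ C P₀ Q₀ A C⊆P₀ C⊆Q₀ C⊆A P₀≢Q₀
    where open Covers C

  meet-unique : ∀ C P Q → set C ⊆ set P → set C ⊆ set Q → set P ≢ set Q →
    set (low Φ P) ∩ set (low Φ Q) ≡ set (meet C)
  meet-unique C P Q C⊆P C⊆Q P≢Q = ⊆-antisym
    (λ x∈ → x∈p∩q⁺ (image-∩⊆ C P Q P₀ C⊆P C⊆Q C⊆P₀ P≢Q x∈ , image-∩⊆ C P Q Q₀ C⊆P C⊆Q C⊆Q₀ P≢Q x∈))
    (λ x∈ → x∈p∩q⁺ (meet⊆low C P C⊆P x∈ , meet⊆low C Q C⊆Q x∈))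
    where open Covers C

module Descent {i m i′ m′} (Φ : LayerIso n (suc i) m (suc i′) m′)
               (levels : Levels n (suc i) m) (levels′ : Levels n (suc i′) m′) where
  open Star Φ levels levels′ public
  private module Back = Star (LayerIso-sym Φ) levels′ levels

  meet-inverse : ∀ C → Back.meet (meet C) ≡ C
  meet-inverse C = Layer-≡ (begin
    set (Back.meet (meet C))                            ≡⟨ Back.meet-unique (meet C) (low Φ P₀) (low Φ Q₀)
                                                             (meet⊆low C P₀ C⊆P₀) (meet⊆low C Q₀ C⊆Q₀) (P₀≢Q₀ ∘′ low-injective Φ) ⟨
    set (low⁻¹ Φ (low Φ P₀)) ∩ set (low⁻¹ Φ (low Φ Q₀)) ≡⟨ cong₂ (λ P Q → set P ∩ set Q) (low⁻¹∘low Φ P₀) (low⁻¹∘low Φ Q₀) ⟩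
    set P₀ ∩ set Q₀                                     ≡⟨ ⋖∧⋖⇒∩≡ (⊆⇒⋖ C P₀ C⊆P₀) (⊆⇒⋖ C Q₀ C⊆Q₀) P₀≢Q₀ ⟩
    set C                                               ∎)
    where
    open Covers C
    open ≡-Reasoning

  meet⊆low⇒⊆ : ∀ C A → set (meet C) ⊆ set (low Φ A) → set C ⊆ set A
  meet⊆low⇒⊆ C A meet⊆A x∈C = back A (Back.image-∩⊆ (meet C) (low Φ P₀) (low Φ Q₀) (low Φ A)
    (meet⊆low C P₀ C⊆P₀) (meet⊆low C Q₀ C⊆Q₀) meet⊆A (P₀≢Q₀ ∘′ low-injective Φ)
    (x∈p∩q⁺ (forth P₀ (C⊆P₀ x∈C) , forth Q₀ (C⊆Q₀ x∈C))))
    where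
    open Covers C
    forth : ∀ {x} P → x ∈ set P → x ∈ set (low⁻¹ Φ (low Φ P))
    forth P = subst (λ S → _ ∈ set S) (sym (low⁻¹∘low Φ P))
    back : ∀ {x} P → x ∈ set (low⁻¹ Φ (low Φ P)) → x ∈ set P
    back P = subst (λ S → _ ∈ set S) (low⁻¹∘low Φ P)

descend : ∀ {i m i′ m′} → LayerIso n (suc i) m (suc i′) m′ → Levels n (suc i) m → Levels n (suc i′) m′ →
  LayerIso n i (suc i) i′ (suc i′)
descend Φ levels levels′ = record
  { low = D.meet ; low⁻¹ = D⁻¹.meet ; high = low Φ ; high⁻¹ = low⁻¹ Φ
  ; low⁻¹∘low = D.meet-inverse
  ; low∘low⁻¹ = λ C′ → Layer-≡ (cong set (D⁻¹.meet-inverse C′))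
  ; high⁻¹∘high = low⁻¹∘low Φ ; high∘high⁻¹ = low∘low⁻¹ Φ
  ; ⊆-preserve = D.meet⊆low ; ⊆-reflect = D.meet⊆low⇒⊆
  }
  where
  -- LayerIso-sym is an involution only up to its proof fields, so only the sets are compared.
  module D = Descent Φ levels levels′
  module D⁻¹ = Descent (LayerIso-sym Φ) levels′ levels

levels↓ : ∀ {i m} → Levels n (suc (suc i)) m → Levels n (suc i) (suc (suc i))
levels↓ levels = record { 1≤j = s≤s z≤n ; j<m = ≤-refl ; m<n = <-trans (Levels.j<m levels) (Levels.m<n levels) }

-- Permutations acting on subsets

preimage : Permutation′ n → Subset n → Subset n
preimage π S = tabulate (λ x → lookup S (π ⟨$⟩ʳ x))

module _ (π : Permutation′ n) where

  ∈-preimage⁻ : ∀ {S} → x ∈ preimage π S → π ⟨$⟩ʳ x ∈ S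
  ∈-preimage⁻ {x = x} {S} x∈π⁻¹S =
    Vec.lookup⇒[]= _ S (trans (sym (Vec.lookup∘tabulate (λ y → lookup S (π ⟨$⟩ʳ y)) x)) (Vec.[]=⇒lookup x∈π⁻¹S))

  ∈-preimage⁺ : ∀ {S} → π ⟨$⟩ʳ x ∈ S → x ∈ preimage π S
  ∈-preimage⁺ {x = x} {S} πx∈S =
    Vec.lookup⇒[]= x _ (trans (Vec.lookup∘tabulate (λ y → lookup S (π ⟨$⟩ʳ y)) x) (Vec.[]=⇒lookup πx∈S))

  preimage-mono : p ⊆ q → preimage π p ⊆ preimage π q
  preimage-mono p⊆q = ∈-preimage⁺ ∘′ p⊆q ∘′ ∈-preimage⁻

  preimage-⁅⁆ : ∀ x → preimage π ⁅ x ⁆ ≡ ⁅ π ⟨$⟩ˡ x ⁆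
  preimage-⁅⁆ x = ⊆-antisym
    (λ {y} y∈ → subst (_∈ ⁅ π ⟨$⟩ˡ x ⁆)
                      (trans (cong (π ⟨$⟩ˡ_) (sym (x∈⁅y⁆⇒x≡y x (∈-preimage⁻ y∈)))) (P.inverseˡ π)) (x∈⁅x⁆ _))
    (λ {y} y∈ → ∈-preimage⁺ (subst (λ z → π ⟨$⟩ʳ z ∈ ⁅ x ⁆) (sym (x∈⁅y⁆⇒x≡y _ y∈))
                                   (subst (_∈ ⁅ x ⁆) (sym (P.inverseʳ π)) (x∈⁅x⁆ x))))

  preimage-∁ : ∀ S → preimage π (∁ S) ≡ ∁ (preimage π S)
  preimage-∁ S = trans (Vec.tabulate-cong (λ y → Vec.lookup-map (π ⟨$⟩ʳ y) not S))
                       (Vec.tabulate-∘ not (λ y → lookup S (π ⟨$⟩ʳ y)))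

  ∣preimage∣ : ∀ S → ∣ preimage π S ∣ ≡ ∣ S ∣
  ∣preimage∣ S = begin
    ∣ preimage π S ∣                        ≡⟨ ∣p∣≡sum (preimage π S) ⟩
    sum (indicator ∘′ lookup (preimage π S)) ≡⟨ sum-cong-≗ (λ i → cong indicator
                                                    (Vec.lookup∘tabulate (λ y → lookup S (π ⟨$⟩ʳ y)) i)) ⟩
    sum (λ y → indicator (lookup S (π ⟨$⟩ʳ y))) ≡⟨ sum-permute (indicator ∘′ lookup S) π ⟨
    sum (indicator ∘′ lookup S)              ≡⟨ ∣p∣≡sum S ⟨
    ∣ S ∣                                     ∎
    where
    open ≡-Reasoning
    indicator : Bool → ℕ
    indicator b = if b then 1 else 0
    ∣p∣≡sum : ∀ {k} (p : Subset k) → ∣ p ∣ ≡ sum (indicator ∘′ lookup p)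
    ∣p∣≡sum []          = refl
    ∣p∣≡sum (true ∷ p)  = cong suc (∣p∣≡sum p)
    ∣p∣≡sum (false ∷ p) = ∣p∣≡sum p

  ∣∁preimage∣ : ∀ S → ∣ ∁ (preimage π S) ∣ ≡ n ∸ ∣ S ∣
  ∣∁preimage∣ S = trans (∣∁p∣≡n∸∣p∣ (preimage π S)) (cong (n ∸_) (∣preimage∣ S))

preimage-∘ : ∀ (π ρ : Permutation′ n) S → preimage π (preimage ρ S) ≡ preimage (π ∘ₚ ρ) S
preimage-∘ π ρ S = Vec.tabulate-cong (λ y → Vec.lookup∘tabulate (λ z → lookup S (ρ ⟨$⟩ʳ z)) (π ⟨$⟩ʳ y))

preimage-cong : ∀ {π ρ : Permutation′ n} → π P.≈ ρ → ∀ S → preimage π S ≡ preimage ρ S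
preimage-cong π≈ρ S = Vec.tabulate-cong (λ x → cong (lookup S) (π≈ρ x))

preimage-id : ∀ {π : Permutation′ n} → π P.≈ P.id → ∀ S → preimage π S ≡ S
preimage-id {π = π} π≈id S = trans (preimage-cong {π = π} {P.id} π≈id S) (Vec.tabulate∘lookup S)

-- Sets of a fixed size 1 ≤ k < n separate points.
preimage-on-layer⇒≈ : ∀ {k} → 1 ≤ k → k < n → (π ρ : Permutation′ n) →
  (∀ (S : Layer n k) → preimage π (set S) ≡ preimage ρ (set S)) → π P.≈ ρ
preimage-on-layer⇒≈ {k = k} 1≤k k<n π ρ same x with π ⟨$⟩ʳ x Fin.≟ ρ ⟨$⟩ʳ x
... | yes πx≡ρx = πx≡ρx
... | no πx≢ρx =
  let S , ⁅πx⁆⊆S , ρx∉S = layer-⊇-avoiding ⁅ π ⟨$⟩ʳ x ⁆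
        (πx≢ρx ∘′ sym ∘′ x∈⁅y⁆⇒x≡y _) (≤-trans (≤-reflexive (∣⁅x⁆∣≡1 (π ⟨$⟩ʳ x))) 1≤k) k<n
  in absurd (ρx∉S (∈-preimage⁻ ρ (subst (x ∈_) (same S) (∈-preimage⁺ π (⁅πx⁆⊆S (x∈⁅x⁆ (π ⟨$⟩ʳ x)))))))

-- Layer isomorphisms come from permutations

layer-through : ∀ {j} (S : Subset n) → x ∈ S → 1 ≤ j → j ≤ ∣ S ∣ → Σ (Layer n j) λ A → x ∈ set A × set A ⊆ S
layer-through {x = x} {j} S x∈S 1≤j j≤∣S∣ =
  let A , ⁅x⁆⊆A , A⊆S , ∣A∣≡j = ∃-between ⁅ x ⁆ S j ⁅x⁆⊆S (≤-trans (≤-reflexive (∣⁅x⁆∣≡1 x)) 1≤j) j≤∣S∣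
  in layer A ∣A∣≡j , ⁅x⁆⊆A (x∈⁅x⁆ x) , A⊆S
  where
  ⁅x⁆⊆S : ⁅ x ⁆ ⊆ S
  ⁅x⁆⊆S y∈⁅x⁆ = subst (_∈ S) (sym (x∈⁅y⁆⇒x≡y x y∈⁅x⁆)) x∈S

-- An m-set is the union of the j-sets it contains, so high Φ is determined by low Φ.
high-preimage : ∀ {j m} → Levels n j m → (Φ : LayerIso n j m j m) (π : Permutation′ n) →
  (∀ A → set (low Φ A) ≡ preimage π (set A)) → ∀ B → set (high Φ B) ≡ preimage π (set B)
high-preimage {j = j} levels Φ π low≡ B = ⊆-antisym high⊆ ⊆high
  where
  open Levels levels
  high⊆ : set (high Φ B) ⊆ preimage π (set B)
  high⊆ {x} x∈highB =
    let A′ , x∈A′ , A′⊆highB = layer-through (set (high Φ B)) x∈highB 1≤j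
                                 (≤-trans (<⇒≤ j<m) (≤-reflexive (sym (size (high Φ B)))))
        A = low⁻¹ Φ A′
        A⊆B = ⊆-reflect Φ A B (subst (λ S → set S ⊆ set (high Φ B)) (sym (low∘low⁻¹ Φ A′)) A′⊆highB)
        x∈lowA = subst (λ S → x ∈ set S) (sym (low∘low⁻¹ Φ A′)) x∈A′
    in ∈-preimage⁺ π (A⊆B (∈-preimage⁻ π (subst (x ∈_) (low≡ A) x∈lowA)))
  ⊆high : preimage π (set B) ⊆ set (high Φ B)
  ⊆high {x} x∈π⁻¹B =
    let A , πx∈A , A⊆B = layer-through (set B) (∈-preimage⁻ π x∈π⁻¹B) 1≤j (≤-trans (<⇒≤ j<m) (≤-reflexive (sym (size B))))
    in ⊆-preserve Φ A B A⊆B (subst (x ∈_) (sym (low≡ A)) (∈-preimage⁺ π πx∈A))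

point : Layer n 1 → Fin n
point A = proj₁ (0<∣p∣⇒Nonempty (set A) (≤-reflexive (sym (size A))))

⁅_⁆ₗ : Fin n → Layer n 1
⁅ x ⁆ₗ = layer ⁅ x ⁆ (∣⁅x⁆∣≡1 x)

⁅point⁆ₗ : (A : Layer n 1) → ⁅ point A ⁆ₗ ≡ A
⁅point⁆ₗ A = Layer-≡ (sym (AtMostOne⇒≡⁅x⁆ (∣p∣≤1⇒AtMostOne (set A) (≤-reflexive (size A)))
                                          (proj₂ (0<∣p∣⇒Nonempty (set A) (≤-reflexive (sym (size A)))))))

point⁅⁆ₗ : (x : Fin n) → point ⁅ x ⁆ₗ ≡ x
point⁅⁆ₗ x = x∈⁅y⁆⇒x≡y x (proj₂ (0<∣p∣⇒Nonempty ⁅ x ⁆ (≤-reflexive (sym (∣⁅x⁆∣≡1 x)))))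

singletons-preimage : ∀ {m} (Φ : LayerIso n 1 m 1 m) → ∃ λ π → ∀ A → set (low Φ A) ≡ preimage π (set A)
singletons-preimage {n} Φ = π , low≡
  where
  to from : Fin n → Fin n
  to x   = point (low⁻¹ Φ ⁅ x ⁆ₗ)
  from x = point (low Φ ⁅ x ⁆ₗ)
  from∘to : ∀ x → from (to x) ≡ x
  from∘to x = trans (cong (point ∘′ low Φ) (⁅point⁆ₗ _)) (trans (cong point (low∘low⁻¹ Φ _)) (point⁅⁆ₗ x))
  to∘from : ∀ x → to (from x) ≡ x
  to∘from x = trans (cong (point ∘′ low⁻¹ Φ) (⁅point⁆ₗ _)) (trans (cong point (low⁻¹∘low Φ _)) (point⁅⁆ₗ x))
  π : Permutation′ n
  π = P.permutation to from to∘from from∘to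
  low≡ : ∀ A → set (low Φ A) ≡ preimage π (set A)
  low≡ A = begin
    set (low Φ A)                        ≡⟨ cong (set ∘′ low Φ) (⁅point⁆ₗ A) ⟨
    set (low Φ ⁅ point A ⁆ₗ)             ≡⟨ cong set (⁅point⁆ₗ _) ⟨
    ⁅ from (point A) ⁆                   ≡⟨ preimage-⁅⁆ π (point A) ⟨
    preimage π ⁅ point A ⁆               ≡⟨ cong (preimage π ∘′ set) (⁅point⁆ₗ A) ⟩
    preimage π (set A)                   ∎
    where open ≡-Reasoning

layer-iso⇒preimage : ∀ {j m} → Levels n j m → (Φ : LayerIso n j m j m) → ∃ λ π → ∀ A → set (low Φ A) ≡ preimage π (set A)
layer-iso⇒preimage {j = zero}        levels Φ = absurd (1+n≰n (Levels.1≤j levels))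
layer-iso⇒preimage {j = suc zero}    levels Φ = singletons-preimage Φ
layer-iso⇒preimage {j = suc (suc i)} levels Φ =
  let π , low≡ = layer-iso⇒preimage (levels↓ levels) (descend Φ levels levels)
  in π , high-preimage (levels↓ levels) (descend Φ levels levels) π low≡

far-pair : ∀ {j} → 2 ≤ j → j + 2 ≤ n → Σ (Layer n j × Layer n j) λ (P , Q) → ¬ AtMostOne (set P ─ set Q)
far-pair {n} {j} 2≤j j+2≤n
  with 1<∣p∣⇒∃-distinct (⊤ {n}) (≤-trans (≤-trans (≤-trans 2≤j (m≤m+n j 2)) j+2≤n) (≤-reflexive (sym (∣⊤∣≡n n))))
... | a , b , _ , _ , a≢b
  with layer-⊇ (⁅ a ⁆ ∪ ⁅ b ⁆) (≤-trans (≤-reflexive ∣ab∣≡2) 2≤j) (≤-trans (m≤m+n j 2) j+2≤n)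
     | layer-⊆ (∁ (⁅ a ⁆ ∪ ⁅ b ⁆)) (≤-trans (m+n≤o⇒m≤o∸n j j+2≤n)
                                   (≤-reflexive (sym (trans (∣∁p∣≡n∸∣p∣ (⁅ a ⁆ ∪ ⁅ b ⁆)) (cong (n ∸_) ∣ab∣≡2)))))
  where
  ∣ab∣≡2 : ∣ ⁅ a ⁆ ∪ ⁅ b ⁆ ∣ ≡ 2
  ∣ab∣≡2 = trans (∣p∪⁅y⁆∣≡1+∣p∣ (a≢b ∘′ sym ∘′ x∈⁅y⁆⇒x≡y a)) (cong suc (∣⁅x⁆∣≡1 a))
...   | P , ab⊆P | Q , Q⊆∁ab = (P , Q) , λ P─Q≤1 → a≢b (P─Q≤1 (∈P─Q (p⊆p∪⁅y⁆ (x∈⁅x⁆ a))) (∈P─Q y∈p∪⁅y⁆))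
  where
  ∈P─Q : ∀ {x} → x ∈ ⁅ a ⁆ ∪ ⁅ b ⁆ → x ∈ set P ─ set Q
  ∈P─Q x∈ab = x∈p∧x∉q⇒x∈p─q (ab⊆P x∈ab) (λ x∈Q → x∈∁p⇒x∉p (Q⊆∁ab x∈Q) x∈ab)

singletons-Johnson : (X Y : Layer n 1) → set X ≢ set Y → Johnson (set X) (set Y)
singletons-Johnson X Y X≢Y = X≢Y , ─≤1 Y X , ─≤1 X Y
  where
  ─≤1 : ∀ (X Y : Layer n 1) → AtMostOne (set X ─ set Y)
  ─≤1 X Y x∈ y∈ = ∣p∣≤1⇒AtMostOne (set X) (≤-reflexive (size X)) (proj₁ (x∈p─q⁻ _ _ x∈)) (proj₁ (x∈p─q⁻ _ _ y∈))

-- Any two distinct singletons are Johnson-adjacent, whereas j-sets for 2 ≤ j need not be.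
¬LayerIso-1-2+ : ∀ {b m m′} → Levels n 1 m → Levels n (2 + b) m′ → ¬ LayerIso n 1 m (2 + b) m′
¬LayerIso-1-2+ {n} {b} levels levels′ Φ =
  let (P , Q) , far = far-pair {n} {2 + b} (s≤s (s≤s z≤n)) (≤-trans (≤-reflexive (+-comm (2 + b) 2)) (≤-trans (s≤s j<m) m<n))
  in far (proj₂ (proj₂ (all-Johnson P Q (λ P≡Q → far (λ x∈P─Q → absurd (proj₂ (x∈p─q⁻ (set P) (set Q) x∈P─Q)
                                                                     (subst (_ ∈_) P≡Q (proj₁ (x∈p─q⁻ _ _ x∈P─Q)))))))))
  where
  open Levels levels′
  all-Johnson : (P Q : Layer n (2 + b)) → set P ≢ set Q → Johnson (set P) (set Q)
  all-Johnson P Q P≢Q = subst₂ (λ P′ Q′ → Johnson (set P′) (set Q′)) (low∘low⁻¹ Φ P) (low∘low⁻¹ Φ Q)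
    (Johnson-transport Φ levels levels′ (low⁻¹ Φ P) (low⁻¹ Φ Q)
      (singletons-Johnson (low⁻¹ Φ P) (low⁻¹ Φ Q) (P≢Q ∘′ low-injective (LayerIso-sym Φ))))

levels-match : ∀ {j m j′ m′} → Levels n j m → Levels n j′ m′ → LayerIso n j m j′ m′ → j ≡ j′
levels-match {j = zero}                   levels _       _ = absurd (1+n≰n (Levels.1≤j levels))
levels-match {j = suc _} {j′ = zero}      _      levels′ _ = absurd (1+n≰n (Levels.1≤j levels′))
levels-match {j = 1}     {j′ = 1}         _      _       _ = refl
levels-match {j = 1}     {j′ = suc (suc _)} levels levels′ Φ = absurd (¬LayerIso-1-2+ levels levels′ Φ)
levels-match {j = suc (suc _)} {j′ = 1} levels levels′ Φ = absurd (¬LayerIso-1-2+ levels′ levels (LayerIso-sym Φ))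
levels-match {j = suc (suc _)} {j′ = suc (suc _)} levels levels′ Φ =
  cong suc (levels-match (levels↓ levels) (levels↓ levels′) (descend Φ levels levels′))

-- The set-inclusion graph and its automorphisms

module SetInclusionGraph {n k l : ℕ} (k<l : k < l) (l<n : l < n) where

  side : Vertex n k l → Bool
  side (_ , inj₁ _) = false
  side (_ , inj₂ _) = true

  Vertex-≡ : {u v : Vertex n k l} → proj₁ u ≡ proj₁ v → u ≡ v
  Vertex-≡ {s , inj₁ p} {.s , inj₁ q} refl = cong (λ r → s , inj₁ r) (≡-irrelevant p q)
  Vertex-≡ {s , inj₂ p} {.s , inj₂ q} refl = cong (λ r → s , inj₂ r) (≡-irrelevant p q)
  Vertex-≡ {s , inj₁ p} {.s , inj₂ q} refl = absurd (<⇒≢ k<l (trans (sym p) q))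
  Vertex-≡ {s , inj₂ p} {.s , inj₁ q} refl = absurd (<⇒≢ k<l (trans (sym q) p))

  vₖ : Layer n k → Vertex n k l
  vₖ (layer s p) = s , inj₁ p

  vₗ : Layer n l → Vertex n k l
  vₗ (layer s p) = s , inj₂ p

  sizeₖ : (v : Vertex n k l) → side v ≡ false → ∣ proj₁ v ∣ ≡ k
  sizeₖ (_ , inj₁ p) _ = p

  sizeₗ : (v : Vertex n k l) → side v ≡ true → ∣ proj₁ v ∣ ≡ l
  sizeₗ (_ , inj₂ p) _ = p

  ⊆⇒Adj : (u v : Vertex n k l) → side u ≡ false → side v ≡ true → proj₁ u ⊆ proj₁ v → Adj u v
  ⊆⇒Adj u v u-low v-high u⊆v =
    (λ u≡v → <⇒≢ k<l (trans (sym (sizeₖ u u-low)) (trans (cong ∣_∣ u≡v) (sizeₗ v v-high)))) , inj₁ u⊆v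

  Adj⇒⊆ : (u v : Vertex n k l) → side u ≡ false → side v ≡ true → Adj u v → proj₁ u ⊆ proj₁ v
  Adj⇒⊆ u v u-low v-high (_ , inj₁ u⊆v) = u⊆v
  Adj⇒⊆ u v u-low v-high (_ , inj₂ v⊆u) = absurd (<⇒≱ k<l
    (≤-trans (≤-reflexive (sym (sizeₗ v v-high))) (≤-trans (p⊆q⇒∣p∣≤∣q∣ v⊆u) (≤-reflexive (sizeₖ u u-low)))))

  Adj-sym : (u v : Vertex n k l) → Adj u v → Adj v u
  Adj-sym u v (u≢v , inj₁ u⊆v) = u≢v ∘′ sym , inj₂ u⊆v
  Adj-sym u v (u≢v , inj₂ v⊆u) = u≢v ∘′ sym , inj₁ v⊆u

  same-side⇒∣∣≡ : (u v : Vertex n k l) → side u ≡ side v → ∣ proj₁ u ∣ ≡ ∣ proj₁ v ∣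
  same-side⇒∣∣≡ (_ , inj₁ p) (_ , inj₁ q) _  = trans p (sym q)
  same-side⇒∣∣≡ (_ , inj₂ p) (_ , inj₂ q) _  = trans p (sym q)
  same-side⇒∣∣≡ (_ , inj₁ _) (_ , inj₂ _) ()
  same-side⇒∣∣≡ (_ , inj₂ _) (_ , inj₁ _) ()

  Adj⇒side≢ : (u v : Vertex n k l) → Adj u v → side u ≢ side v
  Adj⇒side≢ u v (u≢v , inj₁ u⊆v) same = u≢v (p⊆q∧∣q∣≤∣p∣⇒p≡q u⊆v (≤-reflexive (sym (same-side⇒∣∣≡ u v same))))
  Adj⇒side≢ u v (u≢v , inj₂ v⊆u) same = u≢v (sym (p⊆q∧∣q∣≤∣p∣⇒p≡q v⊆u (≤-reflexive (same-side⇒∣∣≡ u v same))))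

  A₀ : Layer n k
  A₀ = proj₁ (layer-⊆ ⊤ (≤-trans (<⇒≤ (<-trans k<l l<n)) (≤-reflexive (sym (∣⊤∣≡n n)))))

  -- G(n,k,l) is connected: A ~ B ~ A − x + y for an l-set B ⊇ A ∪ {y}, and exchanges
  -- reach A₀ from any k-set A, each one decreasing ∣A ─ A₀∣.
  module _ {a} {V : Set a} (c : Vertex n k l → V) (invariant : ∀ u v → Adj u v → c u ≡ c v) where

    invariant-exchange : (A : Layer n k) (x∈A : x ∈ set A) (y∉A : y ∉ set A) → c (vₖ A) ≡ c (vₖ (exchange A x∈A y∉A))
    invariant-exchange {y = y} A x∈A y∉A
      with layer-⊇ (set A ∪ ⁅ y ⁆) (≤-trans (≤-reflexive (trans (∣p∪⁅y⁆∣≡1+∣p∣ y∉A) (cong suc (size A)))) k<l) (<⇒≤ l<n)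
    ... | B , A∪y⊆B = trans (invariant (vₖ A) (vₗ B) (⊆⇒Adj (vₖ A) (vₗ B) refl refl (A∪y⊆B ∘′ p⊆p∪⁅y⁆)))
                            (sym (invariant (vₖ A′) (vₗ B) (⊆⇒Adj (vₖ A′) (vₗ B) refl refl (A∪y⊆B ∘′ exchange⊆∪⁅⁆ A x∈A y∉A))))
      where
      A′ : Layer n k
      A′ = exchange A x∈A y∉A

    invariant-layer : ∀ d (A : Layer n k) → ∣ set A ─ set A₀ ∣ < d → c (vₖ A) ≡ c (vₖ A₀)
    invariant-layer (suc d) A (s≤s ∣A─A₀∣≤d) with ⊆⊎∃∈─ (set A) (set A₀)
    ... | inj₁ A⊆A₀ = cong (c ∘′ vₖ) (Layer-≡ (p⊆q∧∣q∣≤∣p∣⇒p≡q A⊆A₀ (≤-reflexive (trans (size A₀) (sym (size A))))))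
    ... | inj₂ (x , x∈A , x∉A₀) =
      let y , y∈A₀ , y∉A = ∣p∣≤∣q∣⇒∃∈q─p (≤-reflexive (trans (size A) (sym (size A₀)))) (λ A≡A₀ → x∉A₀ (subst (x ∈_) A≡A₀ x∈A))
      in trans (invariant-exchange A x∈A y∉A)
               (invariant-layer d (exchange A x∈A y∉A)
                 (≤-trans (s≤s (p⊆q⇒∣p∣≤∣q∣ (exchange─⊆ A x∈A y∉A y∈A₀)))
                          (≤-trans (x∈p⇒∣p-x∣<∣p∣ (x∈p∧x∉q⇒x∈p─q x∈A x∉A₀)) ∣A─A₀∣≤d)))

    invariant-constant : ∀ v → c v ≡ c (vₖ A₀)
    invariant-constant (s , inj₁ p) = invariant-layer _ (layer s p) ≤-refl
    invariant-constant (s , inj₂ p) =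
      let A , A⊆s = layer-⊆ s (≤-trans (<⇒≤ k<l) (≤-reflexive (sym p)))
      in trans (sym (invariant (vₖ A) (s , inj₂ p) (⊆⇒Adj (vₖ A) (s , inj₂ p) refl refl A⊆s))) (invariant-layer _ A ≤-refl)

xor-≢ : ∀ {a b c d : Bool} → a ≢ b → c ≢ d → c xor a ≡ d xor b
xor-≢ {false} {true}  {false} {true}  _ _ = refl
xor-≢ {false} {true}  {true}  {false} _ _ = refl
xor-≢ {true}  {false} {false} {true}  _ _ = refl
xor-≢ {true}  {false} {true}  {false} _ _ = refl
xor-≢ {false} {false} a≢b _ = absurd (a≢b refl)
xor-≢ {true}  {true}  a≢b _ = absurd (a≢b refl)
xor-≢ {_} {_} {false} {false} _ c≢d = absurd (c≢d refl)
xor-≢ {_} {_} {true}  {true}  _ c≢d = absurd (c≢d refl)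

xor-solve : ∀ {a b c : Bool} → a xor b ≡ c → a ≡ c xor b
xor-solve {false} {false} refl = refl
xor-solve {false} {true}  refl = refl
xor-solve {true}  {false} refl = refl
xor-solve {true}  {true}  refl = refl

xor-swap : ∀ {a b c : Bool} → a ≡ c xor b → b ≡ c xor a
xor-swap {b = false} {false} refl = refl
xor-swap {b = false} {true}  refl = refl
xor-swap {b = true}  {false} refl = refl
xor-swap {b = true}  {true}  refl = refl

Comparable : Subset n → Subset n → Set
Comparable S T = S ≢ T × (S ⊆ T ⊎ T ⊆ S)

act : Bool → Permutation′ n → Subset n → Subset n
act false π S = preimage π S
act true  π S = ∁ (preimage π S)

module _ {n : ℕ} where

  act-∘ : ∀ b c (π ρ : Permutation′ n) S → act b π (act c ρ S) ≡ act (b xor c) (π ∘ₚ ρ) S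
  act-∘ false false π ρ S = preimage-∘ π ρ S
  act-∘ false true  π ρ S = trans (preimage-∁ π (preimage ρ S)) (cong ∁ (preimage-∘ π ρ S))
  act-∘ true  false π ρ S = cong ∁ (preimage-∘ π ρ S)
  act-∘ true  true  π ρ S = trans (cong ∁ (preimage-∁ π (preimage ρ S))) (trans (∁-involutive _) (preimage-∘ π ρ S))

  act-cong : ∀ b {π ρ : Permutation′ n} → π P.≈ ρ → ∀ S → act b π S ≡ act b ρ S
  act-cong false {π} {ρ} π≈ρ S = preimage-cong {π = π} {ρ} π≈ρ S
  act-cong true  {π} {ρ} π≈ρ S = cong ∁ (preimage-cong {π = π} {ρ} π≈ρ S)

  act-inverse : ∀ b (π ρ : Permutation′ n) → π ∘ₚ ρ P.≈ P.id → ∀ S → act b π (act b ρ S) ≡ S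
  act-inverse b π ρ πρ≈id S = begin
    act b π (act b ρ S)      ≡⟨ act-∘ b b π ρ S ⟩
    act (b xor b) (π ∘ₚ ρ) S ≡⟨ cong (λ c → act c (π ∘ₚ ρ) S) (xor-same b) ⟩
    preimage (π ∘ₚ ρ) S      ≡⟨ preimage-id {π = π ∘ₚ ρ} πρ≈id S ⟩
    S                        ∎
    where open ≡-Reasoning

  act≡⇒preimage≡ : ∀ b {π ρ : Permutation′ n} {S} → act b π S ≡ act b ρ S → preimage π S ≡ preimage ρ S
  act≡⇒preimage≡ false π≡ρ = π≡ρ
  act≡⇒preimage≡ true  π≡ρ = trans (sym (∁-involutive _)) (trans (cong ∁ π≡ρ) (∁-involutive _))

  act-flip-inverseˡ : ∀ b (π : Permutation′ n) S → act b (P.flip π) (act b π S) ≡ S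
  act-flip-inverseˡ b π = act-inverse b (P.flip π) π (λ _ → P.inverseʳ π)

  act-flip-inverseʳ : ∀ b (π : Permutation′ n) S → act b π (act b (P.flip π) S) ≡ S
  act-flip-inverseʳ b π = act-inverse b π (P.flip π) (λ _ → P.inverseˡ π)

  act-Comparable : ∀ b (π : Permutation′ n) {S T} → Comparable S T → Comparable (act b π S) (act b π T)
  act-Comparable b π {S} {T} (S≢T , S⊆T∨T⊆S) = S≢T ∘′ injective , nested b S⊆T∨T⊆S
    where
    injective : act b π S ≡ act b π T → S ≡ T
    injective e = trans (sym (act-flip-inverseˡ b π S)) (trans (cong (act b (P.flip π)) e) (act-flip-inverseˡ b π T))
    nested : ∀ b → S ⊆ T ⊎ T ⊆ S → act b π S ⊆ act b π T ⊎ act b π T ⊆ act b π S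
    nested false = [ inj₁ ∘′ preimage-mono π , inj₂ ∘′ preimage-mono π ]
    nested true  = [ inj₂ ∘′ p⊆q⇒∁p⊇∁q ∘′ preimage-mono π , inj₁ ∘′ p⊆q⇒∁p⊇∁q ∘′ preimage-mono π ]

module _ (G H : RawGroup 0ℓ 0ℓ) where
  private
    module G = RawGroup G
    module H = RawGroup H

  inverse⇒isGroupIsomorphism : IsEquivalence G._≈_ → Congruent₂ G._≈_ G._∙_ → Congruent₁ G._≈_ G._⁻¹ →
    (φ : G.Carrier → H.Carrier) (ψ : H.Carrier → G.Carrier) →
    (∀ {x y} → x H.≈ y → ψ x G.≈ ψ y) → (∀ {x y} → ψ x G.≈ ψ y → x H.≈ y) →
    (∀ x y → ψ (x H.∙ y) G.≈ ψ x G.∙ ψ y) → ψ H.ε G.≈ G.ε → (∀ x → ψ (x H.⁻¹) G.≈ ψ x G.⁻¹) →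
    (∀ f → ψ (φ f) G.≈ f) → GroupMorphisms.IsGroupIsomorphism G H φ
  inverse⇒isGroupIsomorphism ≈-equiv ∙-cong ⁻¹-cong φ ψ ψ-cong ψ-injective ψ-∙ ψ-ε ψ-⁻¹ ψ∘φ = record
    { isGroupMonomorphism = record
      { isGroupHomomorphism = record
        { isMonoidHomomorphism = record
          { isMagmaHomomorphism = record
            { isRelHomomorphism = record
                { cong = λ {f} {g} f≈g → ψ-injective (begin ψ (φ f) ≈⟨ ψ∘φ f ⟩ f ≈⟨ f≈g ⟩ g ≈⟨ ψ∘φ g ⟨ ψ (φ g) ∎) }
            ; homo = λ f g → ψ-injective (begin
                ψ (φ (f G.∙ g))       ≈⟨ ψ∘φ (f G.∙ g) ⟩
                f G.∙ g               ≈⟨ ∙-cong (ψ∘φ f) (ψ∘φ g) ⟨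
                ψ (φ f) G.∙ ψ (φ g)   ≈⟨ ψ-∙ (φ f) (φ g) ⟨
                ψ (φ f H.∙ φ g)       ∎)
            }
          ; ε-homo = ψ-injective (begin ψ (φ G.ε) ≈⟨ ψ∘φ G.ε ⟩ G.ε ≈⟨ ψ-ε ⟨ ψ H.ε ∎)
          }
        ; ⁻¹-homo = λ f → ψ-injective (begin
            ψ (φ (f G.⁻¹))    ≈⟨ ψ∘φ (f G.⁻¹) ⟩
            f G.⁻¹            ≈⟨ ⁻¹-cong (ψ∘φ f) ⟨
            ψ (φ f) G.⁻¹      ≈⟨ ψ-⁻¹ (φ f) ⟨
            ψ (φ f H.⁻¹)      ∎)
        }
      ; injective = λ {f} {g} φf≈φg → begin f ≈⟨ ψ∘φ f ⟨ ψ (φ f) ≈⟨ ψ-cong φf≈φg ⟩ ψ (φ g) ≈⟨ ψ∘φ g ⟩ g ∎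
      }
    ; surjective = λ y → ψ y , λ {f} f≈ψy → ψ-injective (begin ψ (φ f) ≈⟨ ψ∘φ f ⟩ f ≈⟨ f≈ψy ⟩ ψ y ∎)
    }
    where
    G-setoid : Setoid 0ℓ 0ℓ
    G-setoid = record { isEquivalence = ≈-equiv }
    open ≈-Reasoning G-setoid

relevel : ∀ {j j′} → j ≡ j′ → Layer n j → Layer n j′
relevel j≡j′ A = layer (set A) (trans (size A) j≡j′)

∁ₗ : ∀ {j} → Layer n j → Layer n (n ∸ j)
∁ₗ {n} A = layer (∁ (set A)) (trans (∣∁p∣≡n∸∣p∣ (set A)) (cong (n ∸_) (size A)))

module Automorphisms {n k l : ℕ} (1≤k : 1 ≤ k) (k<l : k < l) (l<n : l < n) where
  open SetInclusionGraph k<l l<n public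

  levels : Levels n k l
  levels = record { 1≤j = 1≤k ; j<m = k<l ; m<n = l<n }

  n∸l≡k : k + l ≡ n → n ∸ l ≡ k
  n∸l≡k k+l≡n = trans (cong (_∸ l) (sym k+l≡n)) (m+n∸n≡m k l)

  n∸k≡l : k + l ≡ n → n ∸ k ≡ l
  n∸k≡l k+l≡n = trans (cong (_∸ k) (sym k+l≡n)) (m+n∸m≡n k l)

  module Analysis (f : Aut n k l) where
    open Aut f

    swaps : Bool
    swaps = side (to (vₖ A₀))

    side-to : ∀ v → side (to v) ≡ swaps xor side v
    side-to v = xor-solve (trans (invariant-constant (λ u → side (to u) xor side u) edge v) (xor-identityʳ swaps))
      where
      edge : ∀ u w → Adj u w → side (to u) xor side u ≡ side (to w) xor side w
      edge u w u~w = xor-≢ (Adj⇒side≢ u w u~w) (Adj⇒side≢ (to u) (to w) (Equivalence.to (adj u w) u~w))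

    side-from : ∀ v → side (from v) ≡ swaps xor side v
    side-from v = xor-swap {c = swaps} (trans (cong side (sym (to-from v))) (side-to (from v)))

    Adj-preserve : ∀ u v → Adj u v → Adj (to u) (to v)
    Adj-preserve u v = Equivalence.to (adj u v)

    Adj-reflect : ∀ u v → Adj (to u) (to v) → Adj u v
    Adj-reflect u v = Equivalence.from (adj u v)

    module Preserving (preserves : swaps ≡ false) where
      side-to′ : ∀ v → side (to v) ≡ side v
      side-to′ v = trans (side-to v) (cong (_xor side v) preserves)

      side-from′ : ∀ v → side (from v) ≡ side v
      side-from′ v = trans (side-from v) (cong (_xor side v) preserves)

      iso : LayerIso n k l k l
      iso = record
        { low    = λ A → layer (proj₁ (to (vₖ A))) (sizeₖ (to (vₖ A)) (side-to′ (vₖ A)))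
        ; low⁻¹  = λ A → layer (proj₁ (from (vₖ A))) (sizeₖ (from (vₖ A)) (side-from′ (vₖ A)))
        ; high   = λ B → layer (proj₁ (to (vₗ B))) (sizeₗ (to (vₗ B)) (side-to′ (vₗ B)))
        ; high⁻¹ = λ B → layer (proj₁ (from (vₗ B))) (sizeₗ (from (vₗ B)) (side-from′ (vₗ B)))
        ; low⁻¹∘low   = λ A → Layer-≡ (cong proj₁ (trans (cong from (Vertex-≡ refl)) (from-to (vₖ A))))
        ; low∘low⁻¹   = λ A → Layer-≡ (cong proj₁ (trans (cong to (Vertex-≡ refl)) (to-from (vₖ A))))
        ; high⁻¹∘high = λ B → Layer-≡ (cong proj₁ (trans (cong from (Vertex-≡ refl)) (from-to (vₗ B))))
        ; high∘high⁻¹ = λ B → Layer-≡ (cong proj₁ (trans (cong to (Vertex-≡ refl)) (to-from (vₗ B))))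
        ; ⊆-preserve = λ A B A⊆B → Adj⇒⊆ (to (vₖ A)) (to (vₗ B)) (side-to′ (vₖ A)) (side-to′ (vₗ B))
                         (Adj-preserve (vₖ A) (vₗ B) (⊆⇒Adj (vₖ A) (vₗ B) refl refl A⊆B))
        ; ⊆-reflect  = λ A B A⊆B → Adj⇒⊆ (vₖ A) (vₗ B) refl refl
                         (Adj-reflect (vₖ A) (vₗ B) (⊆⇒Adj (to (vₖ A)) (to (vₗ B)) (side-to′ (vₖ A)) (side-to′ (vₗ B)) A⊆B))
        }

    -- Complementing the images of a side-swapping automorphism restores the inclusion order.
    module Swapping (swapping : swaps ≡ true) {k′ l′} (n∸l≡k′ : n ∸ l ≡ k′) (n∸k≡l′ : n ∸ k ≡ l′) where
      side-to′ : ∀ v → side (to v) ≡ not (side v)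
      side-to′ v = trans (side-to v) (cong (_xor side v) swapping)

      side-from′ : ∀ v → side (from v) ≡ not (side v)
      side-from′ v = trans (side-from v) (cong (_xor side v) swapping)

      n∸k′≡l : n ∸ k′ ≡ l
      n∸k′≡l = trans (cong (n ∸_) (sym n∸l≡k′)) (m∸[m∸n]≡n (<⇒≤ l<n))

      n∸l′≡k : n ∸ l′ ≡ k
      n∸l′≡k = trans (cong (n ∸_) (sym n∸k≡l′)) (m∸[m∸n]≡n (<⇒≤ (<-trans k<l l<n)))

      iso : LayerIso n k l k′ l′
      iso = record
        { low    = λ A → relevel n∸l≡k′ (∁ₗ (layer (proj₁ (to (vₖ A))) (sizeₗ (to (vₖ A)) (side-to′ (vₖ A)))))
        ; low⁻¹  = λ A′ → layer (proj₁ (from (∁ᵥₗ A′))) (sizeₖ (from (∁ᵥₗ A′)) (side-from′ (∁ᵥₗ A′)))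
        ; high   = λ B → relevel n∸k≡l′ (∁ₗ (layer (proj₁ (to (vₗ B))) (sizeₖ (to (vₗ B)) (side-to′ (vₗ B)))))
        ; high⁻¹ = λ B′ → layer (proj₁ (from (∁ᵥₖ B′))) (sizeₗ (from (∁ᵥₖ B′)) (side-from′ (∁ᵥₖ B′)))
        ; low⁻¹∘low   = λ A → Layer-≡ (cong proj₁ (trans (cong from (Vertex-≡ (∁-involutive _))) (from-to (vₖ A))))
        ; low∘low⁻¹   = λ A′ → Layer-≡ (trans (cong (∁ ∘′ proj₁) (trans (cong to (Vertex-≡ refl)) (to-from (∁ᵥₗ A′))))
                                            (∁-involutive (set A′)))
        ; high⁻¹∘high = λ B → Layer-≡ (cong proj₁ (trans (cong from (Vertex-≡ (∁-involutive _))) (from-to (vₗ B))))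
        ; high∘high⁻¹ = λ B′ → Layer-≡ (trans (cong (∁ ∘′ proj₁) (trans (cong to (Vertex-≡ refl)) (to-from (∁ᵥₖ B′))))
                                            (∁-involutive (set B′)))
        ; ⊆-preserve = λ A B A⊆B → p⊆q⇒∁p⊇∁q (Adj⇒⊆ (to (vₗ B)) (to (vₖ A)) (side-to′ (vₗ B)) (side-to′ (vₖ A))
                         (Adj-sym (to (vₖ A)) (to (vₗ B)) (Adj-preserve (vₖ A) (vₗ B) (⊆⇒Adj (vₖ A) (vₗ B) refl refl A⊆B))))
        ; ⊆-reflect  = λ A B ∁A⊆∁B → Adj⇒⊆ (vₖ A) (vₗ B) refl refl
                         (Adj-reflect (vₖ A) (vₗ B) (Adj-sym (to (vₗ B)) (to (vₖ A))
                           (⊆⇒Adj (to (vₗ B)) (to (vₖ A)) (side-to′ (vₗ B)) (side-to′ (vₖ A)) (∁p⊆∁q⇒p⊇q ∁A⊆∁B))))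
        }
        where
        ∁ᵥₗ : Layer n k′ → Vertex n k l
        ∁ᵥₗ A′ = vₗ (relevel n∸k′≡l (∁ₗ A′))
        ∁ᵥₖ : Layer n l′ → Vertex n k l
        ∁ᵥₖ B′ = vₖ (relevel n∸l′≡k (∁ₗ B′))

    swapping⇒k+l≡n : swaps ≡ true → k + l ≡ n
    swapping⇒k+l≡n swapping = begin
      k + l     ≡⟨ cong (_+ l) (levels-match levels levels′ (Swapping.iso swapping refl refl)) ⟩
      n ∸ l + l ≡⟨ m∸n+n≡m (<⇒≤ l<n) ⟩
      n         ∎
      where
      open ≡-Reasoning
      levels′ : Levels n (n ∸ l) (n ∸ k)
      levels′ = record
        { 1≤j = m<n⇒0<n∸m l<n
        ; j<m = ∸-monoʳ-< k<l (<⇒≤ l<n)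
        ; m<n = ∸-monoʳ-< {n} {k} {0} 1≤k (<⇒≤ (<-trans k<l l<n))
        }

    decompose : ∃ λ π → ∀ v → proj₁ (to v) ≡ act swaps π (proj₁ v)
    decompose = decompose′ swaps refl
      where
      decompose′ : ∀ b → swaps ≡ b → ∃ λ π → ∀ v → proj₁ (to v) ≡ act b π (proj₁ v)
      decompose′ false preserves =
        π , λ { (s , inj₁ p) → low≡ (layer s p) ; (s , inj₂ p) → high-preimage levels iso π low≡ (layer s p) }
        where
        open Preserving preserves
        π : Permutation′ n
        π = proj₁ (layer-iso⇒preimage levels iso)
        low≡ : ∀ A → set (low iso A) ≡ preimage π (set A)
        low≡ = proj₂ (layer-iso⇒preimage levels iso)
      decompose′ true swapping =
        π , λ { (s , inj₁ p) → un∁ (low≡ (layer s p)) ; (s , inj₂ p) → un∁ (high-preimage levels iso π low≡ (layer s p)) }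
        where
        open Swapping swapping (n∸l≡k (swapping⇒k+l≡n swapping)) (n∸k≡l (swapping⇒k+l≡n swapping))
        π : Permutation′ n
        π = proj₁ (layer-iso⇒preimage levels iso)
        low≡ : ∀ A → set (low iso A) ≡ preimage π (set A)
        low≡ = proj₂ (layer-iso⇒preimage levels iso)
        un∁ : ∀ {S T : Subset n} → ∁ S ≡ T → S ≡ ∁ T
        un∁ {S} ∁S≡T = trans (sym (∁-involutive S)) (cong ∁ ∁S≡T)

  -- Complementation exchanges k-sets and l-sets only when k + l = n.
  Swappable : Bool → Set
  Swappable b = b ≡ true → k + l ≡ n

  act-vertex : (b : Bool) → Permutation′ n → Swappable b → Vertex n k l → Vertex n k l
  act-vertex false π _ (s , inj₁ p) = preimage π s , inj₁ (trans (∣preimage∣ π s) p)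
  act-vertex false π _ (s , inj₂ p) = preimage π s , inj₂ (trans (∣preimage∣ π s) p)
  act-vertex true  π h (s , inj₁ p) =
    ∁ (preimage π s) , inj₂ (trans (∣∁preimage∣ π s) (trans (cong (n ∸_) p) (n∸k≡l (h refl))))
  act-vertex true  π h (s , inj₂ p) =
    ∁ (preimage π s) , inj₁ (trans (∣∁preimage∣ π s) (trans (cong (n ∸_) p) (n∸l≡k (h refl))))

  act-vertex-set : ∀ b π h v → proj₁ (act-vertex b π h v) ≡ act b π (proj₁ v)
  act-vertex-set false π h (s , inj₁ _) = refl
  act-vertex-set false π h (s , inj₂ _) = refl
  act-vertex-set true  π h (s , inj₁ _) = refl
  act-vertex-set true  π h (s , inj₂ _) = refl

  side-act-vertex : ∀ b π h v → side (act-vertex b π h v) ≡ b xor side v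
  side-act-vertex false π h (s , inj₁ _) = refl
  side-act-vertex false π h (s , inj₂ _) = refl
  side-act-vertex true  π h (s , inj₁ _) = refl
  side-act-vertex true  π h (s , inj₂ _) = refl

  induced : (b : Bool) → Permutation′ n → Swappable b → Aut n k l
  induced b π h = record
    { to      = act-vertex b π h
    ; from    = act-vertex b (P.flip π) h
    ; to-from = λ v → Vertex-≡ (inverse π (P.flip π) v (act-flip-inverseʳ b π (proj₁ v)))
    ; from-to = λ v → Vertex-≡ (inverse (P.flip π) π v (act-flip-inverseˡ b π (proj₁ v)))
    ; adj     = λ u v → mk⇔
        (λ u~v → subst₂ Comparable (sym (act-vertex-set b π h u)) (sym (act-vertex-set b π h v)) (act-Comparable b π u~v))
        (λ πu~πv → subst₂ Comparable (act-flip-inverseˡ b π (proj₁ u)) (act-flip-inverseˡ b π (proj₁ v))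
           (act-Comparable b (P.flip π) (subst₂ Comparable (act-vertex-set b π h u) (act-vertex-set b π h v) πu~πv)))
    }
    where
    inverse : ∀ π ρ v → act b π (act b ρ (proj₁ v)) ≡ proj₁ v → proj₁ (act-vertex b π h (act-vertex b ρ h v)) ≡ proj₁ v
    inverse π ρ v πρv≡v = trans (act-vertex-set b π h _) (trans (cong (act b π) (act-vertex-set b ρ h v)) πρv≡v)

  _≈ᴬ_ : Aut n k l → Aut n k l → Set
  f ≈ᴬ g = ∀ v → Aut.to f v ≡ Aut.to g v

  induced-cong : ∀ {b c π ρ} {h : Swappable b} {h′ : Swappable c} → b ≡ c → π P.≈ ρ → induced b π h ≈ᴬ induced c ρ h′
  induced-cong {b} {π = π} {ρ} {h} {h′} refl π≈ρ v =
    Vertex-≡ (trans (act-vertex-set b π h v) (trans (act-cong b π≈ρ (proj₁ v)) (sym (act-vertex-set b ρ h′ v))))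

  induced-∘ : ∀ b c π ρ (h : Swappable (b xor c)) (h₁ : Swappable b) (h₂ : Swappable c) v →
    Aut.to (induced (b xor c) (π ∘ₚ ρ) h) v ≡ Aut.to (induced b π h₁) (Aut.to (induced c ρ h₂) v)
  induced-∘ b c π ρ h h₁ h₂ v = Vertex-≡ (begin
    proj₁ (act-vertex (b xor c) (π ∘ₚ ρ) h v)               ≡⟨ act-vertex-set (b xor c) (π ∘ₚ ρ) h v ⟩
    act (b xor c) (π ∘ₚ ρ) (proj₁ v)                        ≡⟨ act-∘ b c π ρ (proj₁ v) ⟨
    act b π (act c ρ (proj₁ v))                              ≡⟨ cong (act b π) (act-vertex-set c ρ h₂ v) ⟨
    act b π (proj₁ (act-vertex c ρ h₂ v))                    ≡⟨ act-vertex-set b π h₁ (act-vertex c ρ h₂ v) ⟨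
    proj₁ (act-vertex b π h₁ (act-vertex c ρ h₂ v))          ∎)
    where open ≡-Reasoning

  induced-id : ∀ (h : Swappable false) v → Aut.to (induced false P.id h) v ≡ v
  induced-id h v = Vertex-≡ (trans (act-vertex-set false P.id h v) (preimage-id {π = P.id} (λ _ → refl) (proj₁ v)))

  induced-injective : ∀ {b c π ρ} {h : Swappable b} {h′ : Swappable c} → induced b π h ≈ᴬ induced c ρ h′ → b ≡ c × π P.≈ ρ
  induced-injective {b} {c} {π} {ρ} {h} {h′} same with b≡c
    where
    b≡c : b ≡ c
    b≡c = begin
      b                                      ≡⟨ xor-identityʳ b ⟨
      b xor false                            ≡⟨ side-act-vertex b π h (vₖ A₀) ⟨
      side (act-vertex b π h (vₖ A₀))        ≡⟨ cong side (same (vₖ A₀)) ⟩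
      side (act-vertex c ρ h′ (vₖ A₀))       ≡⟨ side-act-vertex c ρ h′ (vₖ A₀) ⟩
      c xor false                            ≡⟨ xor-identityʳ c ⟩
      c                                      ∎
      where open ≡-Reasoning
  ... | refl = refl , preimage-on-layer⇒≈ 1≤k (<-trans k<l l<n) π ρ (λ S → act≡⇒preimage≡ b (same-act S))
    where
    same-act : ∀ S → act b π (set S) ≡ act b ρ (set S)
    same-act S = trans (sym (act-vertex-set b π h (vₖ S))) (trans (cong proj₁ (same (vₖ S))) (act-vertex-set b ρ h′ (vₖ S)))

  permutation-of : Aut n k l → Permutation′ n
  permutation-of f = proj₁ (Analysis.decompose f)

  induced-decomposition : ∀ f → induced (Analysis.swaps f) (permutation-of f) (Analysis.swapping⇒k+l≡n f) ≈ᴬ f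
  induced-decomposition f v = Vertex-≡ (trans (act-vertex-set (Analysis.swaps f) (permutation-of f) (Analysis.swapping⇒k+l≡n f) v)
                                              (sym (proj₂ (Analysis.decompose f) v)))

  ≈ᴬ-isEquivalence : IsEquivalence _≈ᴬ_
  ≈ᴬ-isEquivalence = record
    { refl = λ v → refl ; sym = λ f≈g v → sym (f≈g v) ; trans = λ f≈g g≈h v → trans (f≈g v) (g≈h v) }

  ∘-cong : Congruent₂ _≈ᴬ_ (RawGroup._∙_ (AutGroup n k l))
  ∘-cong {f} {f′} {g} {g′} f≈f′ g≈g′ v = trans (cong (Aut.to f) (g≈g′ v)) (f≈f′ (Aut.to g′ v))

  inverse-cong : Congruent₁ _≈ᴬ_ (RawGroup._⁻¹ (AutGroup n k l))
  inverse-cong {f} {g} f≈g v = begin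
    Aut.from f v                        ≡⟨ Aut.from-to g (Aut.from f v) ⟨
    Aut.from g (Aut.to g (Aut.from f v)) ≡⟨ cong (Aut.from g) (f≈g (Aut.from f v)) ⟨
    Aut.from g (Aut.to f (Aut.from f v)) ≡⟨ cong (Aut.from g) (Aut.to-from f v) ⟩
    Aut.from g v                        ∎
    where open ≡-Reasoning

  Aut≅Sym : k + l < n → AutGroup n k l ≅ Sym n
  Aut≅Sym k+l<n = permutation-of , inverse⇒isGroupIsomorphism (AutGroup n k l) (Sym n) ≈ᴬ-isEquivalence
    (λ {f} {f′} {g} {g′} → ∘-cong {f} {f′} {g} {g′}) (λ {f} {g} → inverse-cong {f} {g})
    permutation-of (λ π → induced false π (λ ()))
    (induced-cong refl) (proj₂ ∘′ induced-injective)
    (λ π ρ → induced-∘ false false π ρ _ _ _) (induced-id _) (λ π v → refl)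
    (λ f v → trans (induced-cong (sym (preserves f)) (λ _ → refl) v) (induced-decomposition f v))
    where
    preserves : ∀ f → Analysis.swaps f ≡ false
    preserves f = ¬-not (<⇒≢ k+l<n ∘′ Analysis.swapping⇒k+l≡n f)

  Aut≅Sym×Z₂ : k + l ≡ n → AutGroup n k l ≅ Sym×Z₂ n
  Aut≅Sym×Z₂ k+l≡n = φ , inverse⇒isGroupIsomorphism (AutGroup n k l) (Sym×Z₂ n) ≈ᴬ-isEquivalence
    (λ {f} {f′} {g} {g′} → ∘-cong {f} {f′} {g} {g′}) (λ {f} {g} → inverse-cong {f} {g})
    φ ψ
    (λ (π≈ρ , b≡c) → induced-cong b≡c π≈ρ) (λ ψ≈ψ → let b≡c , π≈ρ = induced-injective ψ≈ψ in π≈ρ , b≡c)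
    (λ (π , b) (ρ , c) → induced-∘ b c π ρ _ _ _) (induced-id _) (λ _ v → refl)
    (λ f v → trans (induced-cong refl (λ _ → refl) v) (induced-decomposition f v))
    where
    φ : Aut n k l → Permutation′ n × Bool
    φ f = permutation-of f , Analysis.swaps f
    ψ : Permutation′ n × Bool → Aut n k l
    ψ (π , b) = induced b π (λ _ → k+l≡n)

theorem1p2 : (n k l : ℕ) → 1 ≤ k → k < l → l ≤ n ∸ 1 → k + l ≤ n →
    ((k + l < n → AutGroup n k l ≅ Sym n) ×
     (k + l ≡ n → AutGroup n k l ≅ Sym×Z₂ n))
theorem1p2 n k l 1≤k k<l l≤n∸1 k+l≤n = Aut≅Sym , Aut≅Sym×Z₂
  where
  l<n : l < n
  l<n = ≤-trans (≤-reflexive (+-comm 1 l)) (m≤o∸n⇒m+n≤o l (≤-trans 1≤k (≤-trans (m≤m+n k l) k+l≤n)) l≤n∸1)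
  open Automorphisms 1≤k k<l l<n
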